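{- There is a universal constant $C>0$ such that the following holds. Let $G$ be an $n$-vertex graph with degeneracy $\kappa$. Let $k \in [1,n]$ (a "guess" for $\kappa$) and let $s \ge Cn\log n$ (a sparsity parameter). Put \[ \ell = \left\lceil \frac{2nk}{s} \right\rceil, \qquad \lambda = 3\sqrt{\kappa \ell \log n}, \] and let $\psi\colon V(G)\to[\ell]$ be a uniformly random coloring, i.e., each vertex independently receives a color chosen uniformly from $[\ell]=\{1,\dots,\ell\}$. For $i\in[\ell]$ let $G_i$ be the subgraph of $G$ induced by $\psi^{ -1}(i)$. Then: (i) if $k\le 2\kappa$, then with probability at least $1-1/\mathrm{poly}(n)$, for every $i$, the degeneracy $\kappa(G_i)\le (\kappa+\lambda)/\ell$; (ii) with probability at least $1-1/\mathrm{poly}(n)$, for every $i$, $|V(G_i)|\le 2n/\ell$; (iii) if $\kappa\le k\le 2\kappa$, then with probability at least $1-1/\mathrm{poly}(n)$, the number of monochromatic edges $|E(G_1)\cup\cdots\cup E(G_\ell)|$ is at most $s$.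
   Context: Graphs are simple, undirected. $\log$ denotes $\log_2$. A graph is $k$-degenerate if every induced subgraph has a vertex of degree at most $k$; the degeneracy $\kappa(G)$ is the smallest such $k$. -}

module Defs where

open import Data.Nat using (ℕ; zero; suc; _+_; _*_; _∸_; _^_; _≤_; _<_)
open import Data.Nat.DivMod using (_/_)
open import Data.Bool using (Bool; true; false; if_then_else_; _∧_)
open import Data.Fin using (Fin; _<?_) renaming (zero to fzero; suc to fsuc)
import Data.Fin as Fin
open import Data.Vec using (Vec; lookup)
open import Data.List using (List; length)
open import Data.List.Membership.Propositional using (_∉_)
open import Data.Product using (Σ; ∃; _×_)
open import Relation.Nullary.Decidable using (⌊_⌋)
open import Relation.Binary.PropositionalEquality using (_≡_)

record Graph (n : ℕ) : Set where
  field
    adj   : Fin n → Fin n → Bool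
    sym   : ∀ u v → adj u v ≡ adj v u
    irrefl : ∀ v → adj v v ≡ false
open Graph public

count : ∀ {n} → (Fin n → Bool) → ℕ
count {zero}  f = 0
count {suc n} f = (if f fzero then 1 else 0) + count (λ i → f (fsuc i))

sumFin : ∀ {n} → (Fin n → ℕ) → ℕ
sumFin {zero}  f = 0
sumFin {suc n} f = f fzero + sumFin (λ i → f (fsuc i))

Subset : ℕ → Set
Subset n = Fin n → Bool

_⊆_ : ∀ {n} → Subset n → Subset n → Set
S ⊆ T = ∀ v → S v ≡ true → T v ≡ true

degIn : ∀ {n} → Graph n → Subset n → Fin n → ℕ
degIn G S v = count (λ u → S u ∧ adj G v u)

DegenerateOn : ∀ {n} → Graph n → Subset n → ℕ → Set
DegenerateOn G T k =
  ∀ (S : Subset _) → S ⊆ T → (∃ λ v → S v ≡ true) →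
  ∃ λ v → S v ≡ true × degIn G S v ≤ k

IsDegeneracyOn : ∀ {n} → Graph n → Subset n → ℕ → Set
IsDegeneracyOn G T d = DegenerateOn G T d × (∀ k → DegenerateOn G T k → d ≤ k)

allV : ∀ {n} → Subset n
allV _ = true

IsDegeneracy : ∀ {n} → Graph n → ℕ → Set
IsDegeneracy G d = IsDegeneracyOn G allV d

ceilDiv : ℕ → (s : ℕ) → .{{_ : Data.Nat.NonZero s}} → ℕ
ceilDiv a s = (a + (s ∸ 1)) / s

Colouring : ℕ → ℕ → Set
Colouring n ℓ = Vec (Fin ℓ) n

colourClass : ∀ {n ℓ} → Colouring n ℓ → Fin ℓ → Subset n
colourClass ψ i v = ⌊ lookup ψ v Fin.≟ i ⌋

monoEdges : ∀ {n ℓ} → Graph n → Colouring n ℓ → ℕ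
monoEdges G ψ =
  sumFin (λ u → count (λ v →
    ⌊ u <? v ⌋ ∧ (adj G u v ∧ ⌊ lookup ψ u Fin.≟ lookup ψ v ⌋)))

-- "with probability at least 1 - n^(-p/q)" over a uniformly random
-- colouring ψ ∈ [ℓ]^n: the set of colourings violating P has at most
-- ℓ^n · n^(-p/q) elements, i.e. it is covered by a list B with
-- |B|^q · n^p ≤ (ℓ^n)^q.
WithProb≥1-n^-[_/_] : ℕ → ℕ → (n ℓ : ℕ) → (Colouring n ℓ → Set) → Set
WithProb≥1-n^-[ p / q ] n ℓ P =
  Σ (List (Colouring n ℓ)) λ B →
    (length B ^ q) * (n ^ p) ≤ (ℓ ^ n) ^ q × (∀ ψ → ψ ∉ B → P ψ)

-- Probability is counting: an event holds "with probability ≥ 1 - n^(-1/4)"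
-- when the failing colourings fit in a list B with |B|^4 · n ≤ (ℓ^n)^4.
-- Every claim is proved by an exponential-moment (Chernoff) bound followed by
-- a union bound; weighted sums over colourings factorise over the vertices
-- (colSum-prod).  For (i) and (iii) the vertices are ordered by a degeneracy
-- ranking, so each has at most κ forward neighbours; w.h.p. fewer than a
-- threshold J₀ of them share its colour (SameColourTail), which makes every
-- class (J₀ - 1)-degenerate and bounds the monochromatic edges.  For (ii) the
-- class sizes are controlled by the weight 2^|class|.

module Submission where

open import Defs renaming (sym to adj-sym)
open import Data.Nat
open import Data.Nat.Properties
open import Data.Nat.DivMod
open import Data.Nat.Tactic.RingSolver using (solve-∀)
open import Data.Nat.Solver using (module +-*-Solver)
open +-*-Solver using (solve; _:*_; _:^_; _:=_)
open import Data.Bool using (Bool; true; false; if_then_else_; _∧_; not; _∨_)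
import Data.Bool.Properties as BoolP
open import Data.Fin using (Fin) renaming (zero to fzero; suc to fsuc)
import Data.Fin as Fin
import Data.Fin.Properties as FinP
open import Data.Vec using (lookup; []; _∷_)
open import Data.List using (List; length; map; _++_) renaming ([] to []ₗ; _∷_ to _∷ₗ_)
open import Data.List.Properties using (length-++; length-map)
open import Data.List.Membership.Propositional using (_∈_; _∉_)
open import Data.List.Membership.Propositional.Properties using (∈-++⁺ˡ; ∈-++⁺ʳ; ∈-map⁺)
open import Data.List.Relation.Unary.Any using (here)
open import Data.Product using (Σ; ∃; _×_; _,_; proj₁; proj₂)
open import Data.Sum using (_⊎_; inj₁; inj₂; [_,_]′)
open import Data.Empty using (⊥; ⊥-elim)
open import Relation.Nullary using (¬_)
open import Relation.Nullary.Decidable using (⌊_⌋; yes; no; Dec; ⌊⌋-map′; from-yes)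
open import Relation.Binary.Definitions using (tri<; tri≈; tri>)
open import Relation.Binary.PropositionalEquality

ind : Bool → ℕ
ind true  = 1
ind false = 0

∧-l : ∀ {a b} → a ∧ b ≡ true → a ≡ true
∧-l {true} _ = refl

∧-r : ∀ {a b} → a ∧ b ≡ true → b ≡ true
∧-r {true} e = e

∧-i : ∀ {a b} → a ≡ true → b ≡ true → a ∧ b ≡ true
∧-i refl refl = refl

isYes-true : ∀ {P : Set} (d : Dec P) → P → ⌊ d ⌋ ≡ true
isYes-true (yes _) _ = refl
isYes-true (no ¬p) p = ⊥-elim (¬p p)

isYes-false : ∀ {P : Set} (d : Dec P) → ¬ P → ⌊ d ⌋ ≡ false
isYes-false (yes p) ¬p = ⊥-elim (¬p p)
isYes-false (no _)  _  = refl

isYes-sound : ∀ {P : Set} (d : Dec P) → ⌊ d ⌋ ≡ true → P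
isYes-sound (yes p) _ = p

isYes-no : ∀ {P : Set} (d : Dec P) → ⌊ d ⌋ ≡ false → ¬ P
isYes-no d e p with () ← trans (sym (isYes-true d p)) e

≟-suc : ∀ {n} (c i : Fin n) → ⌊ fsuc c Fin.≟ fsuc i ⌋ ≡ ⌊ c Fin.≟ i ⌋
≟-suc c i = ⌊⌋-map′ (cong fsuc) FinP.suc-injective (c Fin.≟ i)

≟-sym : ∀ {n} (a b : Fin n) → ⌊ a Fin.≟ b ⌋ ≡ ⌊ b Fin.≟ a ⌋
≟-sym a b with a Fin.≟ b
... | yes e = sym (isYes-true (b Fin.≟ a) (sym e))
... | no ne = sym (isYes-false (b Fin.≟ a) (λ e → ne (sym e)))

<-xor : ∀ {a b : ℕ} (d₁ : Dec (a < b)) (d₂ : Dec (b < a)) → a ≢ b →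
        ind ⌊ d₁ ⌋ + ind ⌊ d₂ ⌋ ≡ 1
<-xor {a} {b} d₁ d₂ a≢b with <-cmp a b
... | tri< p _ _ rewrite isYes-true d₁ p | isYes-false d₂ (<⇒≯ p) = refl
... | tri≈ _ e _ = ⊥-elim (a≢b e)
... | tri> _ _ p rewrite isYes-false d₁ (<⇒≯ p) | isYes-true d₂ p = refl

least : (P : ℕ → Set) → (∀ j → Dec (P j)) → ∀ B → P B →
        ∃ λ J → P J × (∀ j → j < J → ¬ P j)
least P P? B pB with search B
  where
  search : ∀ B → (∃ λ J → J ≤ B × P J × (∀ j → j < J → ¬ P j)) ⊎ (∀ j → j ≤ B → ¬ P j)
  search zero with P? zero
  ... | yes p = inj₁ (zero , z≤n , p , λ _ ())
  ... | no ¬p = inj₂ λ { zero _ → ¬p }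
  search (suc B) with search B | P? (suc B)
  ... | inj₁ (J , J≤B , p , below) | _ = inj₁ (J , m≤n⇒m≤1+n J≤B , p , below)
  ... | inj₂ none | yes p = inj₁ (suc B , ≤-refl , p , λ j j< → none j (≤-pred j<))
  ... | inj₂ none | no ¬p = inj₂ λ j j≤ → [ (λ j< → none j (≤-pred j<)) , (λ { refl → ¬p }) ]′ (m≤n⇒m<n∨m≡n j≤)
... | inj₁ (J , _ , p , below) = J , p , below
... | inj₂ none = ⊥-elim (none B ≤-refl pB)

sumFin-cong : ∀ {n} (f g : Fin n → ℕ) → (∀ i → f i ≡ g i) → sumFin f ≡ sumFin g
sumFin-cong {zero}  f g h = refl
sumFin-cong {suc n} f g h = cong₂ _+_ (h fzero) (sumFin-cong _ _ (λ i → h (fsuc i)))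

sumFin-mono : ∀ {n} (f g : Fin n → ℕ) → (∀ i → f i ≤ g i) → sumFin f ≤ sumFin g
sumFin-mono {zero}  f g h = z≤n
sumFin-mono {suc n} f g h = +-mono-≤ (h fzero) (sumFin-mono _ _ (λ i → h (fsuc i)))

sumFin-+ : ∀ {n} (f g : Fin n → ℕ) → sumFin (λ i → f i + g i) ≡ sumFin f + sumFin g
sumFin-+ {zero}  f g = refl
sumFin-+ {suc n} f g =
  trans (cong (f fzero + g fzero +_) (sumFin-+ (λ i → f (fsuc i)) (λ i → g (fsuc i))))
        (interchange (f fzero) (g fzero) _ _)
  where interchange : ∀ a b c d → a + b + (c + d) ≡ a + c + (b + d)
        interchange = solve-∀

sumFin-*ʳ : ∀ {n} (f : Fin n → ℕ) K → sumFin (λ i → f i * K) ≡ sumFin f * K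
sumFin-*ʳ {zero}  f K = refl
sumFin-*ʳ {suc n} f K = trans (cong (f fzero * K +_) (sumFin-*ʳ (λ i → f (fsuc i)) K))
                              (sym (*-distribʳ-+ K (f fzero) _))

sumFin-*ˡ : ∀ {n} (f : Fin n → ℕ) K → sumFin (λ i → K * f i) ≡ K * sumFin f
sumFin-*ˡ f K = trans (sumFin-cong _ _ (λ i → *-comm K (f i)))
                      (trans (sumFin-*ʳ f K) (*-comm (sumFin f) K))

sumFin-const : ∀ n c → sumFin {n} (λ _ → c) ≡ n * c
sumFin-const zero    c = refl
sumFin-const (suc n) c = cong (c +_) (sumFin-const n c)

sumFin-≥ : ∀ {n} (f : Fin n → ℕ) i → f i ≤ sumFin f
sumFin-≥ f fzero    = m≤m+n _ _
sumFin-≥ f (fsuc i) = ≤-trans (sumFin-≥ (λ j → f (fsuc j)) i) (m≤n+m _ _)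

sumFin-≤max : ∀ {n} (f : Fin n → ℕ) M → (∀ u → f u ≤ M) → sumFin f ≤ n * M
sumFin-≤max {n} f M h = ≤-trans (sumFin-mono f (λ _ → M) h) (≤-reflexive (sumFin-const n M))

sumFin-swap : ∀ {n m} (h : Fin n → Fin m → ℕ) →
  sumFin (λ u → sumFin (λ v → h u v)) ≡ sumFin (λ v → sumFin (λ u → h u v))
sumFin-swap {zero}  {m} h = sym (trans (sumFin-const m 0) (*-zeroʳ m))
sumFin-swap {suc n} h =
  trans (cong (sumFin (h fzero) +_) (sumFin-swap (λ u v → h (fsuc u) v)))
        (sym (sumFin-+ (h fzero) _))

sumFin-bump : ∀ {ℓ} (i : Fin ℓ) b t →
  sumFin (λ c → if ⌊ c Fin.≟ i ⌋ then b + t else b) ≡ ℓ * b + t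
sumFin-bump {suc ℓ} fzero b t = begin
    b + t + sumFin {ℓ} (λ _ → b)  ≡⟨ cong (b + t +_) (sumFin-const ℓ b) ⟩
    b + t + ℓ * b                 ≡⟨ rearrange b t (ℓ * b) ⟩
    b + ℓ * b + t                 ∎
  where open ≡-Reasoning
        rearrange : ∀ x y z → x + y + z ≡ x + z + y
        rearrange = solve-∀
sumFin-bump {suc ℓ} (fsuc i) b t = begin
    b + sumFin (λ c → if ⌊ fsuc c Fin.≟ fsuc i ⌋ then b + t else b)
      ≡⟨ cong (b +_) (sumFin-cong _ _ (λ c → cong (if_then b + t else b) (≟-suc c i))) ⟩
    b + sumFin (λ c → if ⌊ c Fin.≟ i ⌋ then b + t else b)
      ≡⟨ cong (b +_) (sumFin-bump i b t) ⟩
    b + (ℓ * b + t)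
      ≡⟨ sym (+-assoc b _ t) ⟩
    b + ℓ * b + t ∎
  where open ≡-Reasoning

argmax : ∀ {n} (f : Fin (suc n) → ℕ) → ∃ λ v → ∀ u → f u ≤ f v
argmax {zero}  f = fzero , λ { fzero → ≤-refl }
argmax {suc n} f with argmax (λ i → f (fsuc i))
... | w , hw with f fzero ≤? f (fsuc w)
...   | yes p = fsuc w , λ { fzero → p ; (fsuc u) → hw u }
...   | no ¬p = fzero , λ { fzero → ≤-refl ; (fsuc u) → ≤-trans (hw u) (<⇒≤ (≰⇒> ¬p)) }

count≡sum : ∀ {n} (f : Fin n → Bool) → count f ≡ sumFin (λ i → ind (f i))
count≡sum {zero}  f = refl
count≡sum {suc n} f with f fzero
... | true  = cong suc (count≡sum (λ i → f (fsuc i)))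
... | false = count≡sum (λ i → f (fsuc i))

count-mono : ∀ {n} (f g : Fin n → Bool) → (∀ i → f i ≡ true → g i ≡ true) → count f ≤ count g
count-mono {zero}  f g h = z≤n
count-mono {suc n} f g h with f fzero in e₁ | g fzero in e₂
... | true  | true  = s≤s (count-mono _ _ (λ i → h (fsuc i)))
... | true  | false with () ← trans (sym (h fzero e₁)) e₂
... | false | true  = ≤-trans (count-mono _ _ (λ i → h (fsuc i))) (n≤1+n _)
... | false | false = count-mono _ _ (λ i → h (fsuc i))

count≤n : ∀ {n} (f : Fin n → Bool) → count f ≤ n
count≤n {zero}  f = z≤n
count≤n {suc n} f with f fzero
... | true  = s≤s (count≤n _)
... | false = ≤-trans (count≤n _) (n≤1+n _)

count-pos : ∀ {n} (f : Fin n → Bool) i → f i ≡ true → 1 ≤ count f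
count-pos f i e = begin
  1                          ≡⟨ cong ind (sym e) ⟩
  ind (f i)                  ≤⟨ sumFin-≥ (λ j → ind (f j)) i ⟩
  sumFin (λ j → ind (f j))   ≡⟨ sym (count≡sum f) ⟩
  count f                    ∎
  where open ≤-Reasoning

count-split : ∀ {n} (f g : Fin n → Bool) →
  count (λ i → f i ∧ g i) + count (λ i → f i ∧ not (g i)) ≡ count f
count-split {zero}  f g = refl
count-split {suc n} f g with f fzero | g fzero | count-split (λ i → f (fsuc i)) (λ i → g (fsuc i))
... | true  | true  | ih = cong suc ih
... | true  | false | ih = trans (+-suc _ _) (cong suc ih)
... | false | _     | ih = ih

anyFin : ∀ {n} → (Fin n → Bool) → Bool
anyFin {zero}  f = false
anyFin {suc n} f = f fzero ∨ anyFin (λ i → f (fsuc i))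

anyFin-false : ∀ {n} (f : Fin n → Bool) → anyFin f ≡ false → ∀ i → f i ≡ false
anyFin-false {suc n} f e i with f fzero in e₀
anyFin-false {suc n} f e fzero    | false = e₀
anyFin-false {suc n} f e (fsuc i) | false = anyFin-false (λ i → f (fsuc i)) e i

anyFin-true : ∀ {n} (f : Fin n → Bool) → anyFin f ≡ true → ∃ λ i → f i ≡ true
anyFin-true {suc n} f e with f fzero in e₀
... | true = fzero , e₀
... | false with anyFin-true (λ i → f (fsuc i)) e
...   | i , eᵢ = fsuc i , eᵢ

anyFin-intro : ∀ {n} (f : Fin n → Bool) i → f i ≡ true → anyFin f ≡ true
anyFin-intro f fzero e rewrite e = refl
anyFin-intro f (fsuc i) e with f fzero
... | true  = refl
... | false = anyFin-intro (λ i → f (fsuc i)) i e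

anyFin-ind : ∀ {n} (f : Fin n → Bool) → ind (anyFin f) ≤ sumFin (λ i → ind (f i))
anyFin-ind {zero}  f = z≤n
anyFin-ind {suc n} f with f fzero
... | true  = s≤s z≤n
... | false = anyFin-ind (λ i → f (fsuc i))

prodFin : ∀ {n} → (Fin n → ℕ) → ℕ
prodFin {zero}  f = 1
prodFin {suc n} f = f fzero * prodFin (λ i → f (fsuc i))

prodFin-cong : ∀ {n} (f g : Fin n → ℕ) → (∀ i → f i ≡ g i) → prodFin f ≡ prodFin g
prodFin-cong {zero}  f g h = refl
prodFin-cong {suc n} f g h = cong₂ _*_ (h fzero) (prodFin-cong _ _ (λ i → h (fsuc i)))

prodFin-* : ∀ {n} (f g : Fin n → ℕ) → prodFin (λ i → f i * g i) ≡ prodFin f * prodFin g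
prodFin-* {zero}  f g = refl
prodFin-* {suc n} f g =
  trans (cong (f fzero * g fzero *_) (prodFin-* (λ i → f (fsuc i)) (λ i → g (fsuc i))))
        (interchange (f fzero) (g fzero) _ _)
  where interchange : ∀ a b c d → a * b * (c * d) ≡ a * c * (b * d)
        interchange = solve-∀

prodFin-const : ∀ n c → prodFin {n} (λ _ → c) ≡ c ^ n
prodFin-const zero    c = refl
prodFin-const (suc n) c = cong (c *_) (prodFin-const n c)

prodFin-pow : ∀ {n} (P Q : Fin n → Bool) x y →
  prodFin (λ u → if P u then (if Q u then x else y) else 1)
    ≡ x ^ count (λ u → P u ∧ Q u) * y ^ count (λ u → P u ∧ not (Q u))
prodFin-pow {zero} P Q x y = refl
prodFin-pow {suc n} P Q x y with P fzero | Q fzero | prodFin-pow (λ i → P (fsuc i)) (λ i → Q (fsuc i)) x y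
... | true  | true  | ih = trans (cong (x *_) ih) (sym (*-assoc x _ _))
... | true  | false | ih = trans (cong (y *_) ih) (rotate y (x ^ count (λ u → P (fsuc u) ∧ Q (fsuc u))) _)
  where rotate : ∀ a b c → a * (b * c) ≡ b * (a * c)
        rotate = solve-∀
... | false | _     | ih = trans (+-identityʳ _) ih

prodFin-ifF : ∀ {n} (F : Fin n → Bool) A z →
  prodFin (λ u → if F u then A else z) * z ^ count F ≡ z ^ n * A ^ count F
prodFin-ifF {zero} F A z = refl
prodFin-ifF {suc n} F A z with F fzero | prodFin-ifF (λ i → F (fsuc i)) A z
... | true  | ih = begin
    A * p * (z * z ^ c)      ≡⟨ shuffle₁ A p z (z ^ c) ⟩
    z * (p * z ^ c) * A      ≡⟨ cong (λ w → z * w * A) ih ⟩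
    z * (z ^ n * A ^ c) * A  ≡⟨ shuffle₂ z (z ^ n) (A ^ c) A ⟩
    z * z ^ n * (A * A ^ c)  ∎
  where
  open ≡-Reasoning
  p = prodFin (λ u → if F (fsuc u) then A else z)
  c = count (λ u → F (fsuc u))
  shuffle₁ : ∀ a p z q → a * p * (z * q) ≡ z * (p * q) * a
  shuffle₁ = solve-∀
  shuffle₂ : ∀ z x y a → z * (x * y) * a ≡ z * x * (a * y)
  shuffle₂ = solve-∀
... | false | ih = trans (*-assoc z _ _) (trans (cong (z *_) ih) (sym (*-assoc z _ _)))

prodFin-single : ∀ {n} (v : Fin n) x → prodFin (λ u → if ⌊ u Fin.≟ v ⌋ then x else 1) ≡ x
prodFin-single {suc n} fzero x = trans (cong (x *_) (trans (prodFin-const n 1) (^-zeroˡ n))) (*-identityʳ x)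
prodFin-single {suc n} (fsuc v) x =
  trans (+-identityʳ _)
        (trans (prodFin-cong _ _ (λ u → cong (if_then x else 1) (≟-suc u v))) (prodFin-single v x))

colSum : ∀ {n ℓ} → (Colouring n ℓ → ℕ) → ℕ
colSum {zero}  F = F []
colSum {suc n} F = sumFin (λ c → colSum (λ ψ → F (c ∷ ψ)))

colSum-mono : ∀ {n ℓ} (F G : Colouring n ℓ → ℕ) → (∀ ψ → F ψ ≤ G ψ) → colSum F ≤ colSum G
colSum-mono {zero}  F G h = h []
colSum-mono {suc n} F G h = sumFin-mono _ _ (λ c → colSum-mono _ _ (λ ψ → h (c ∷ ψ)))

colSum-*ˡ : ∀ {n ℓ} (F : Colouring n ℓ → ℕ) K → colSum (λ ψ → K * F ψ) ≡ K * colSum F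
colSum-*ˡ {zero}  F K = refl
colSum-*ˡ {suc n} F K =
  trans (sumFin-cong _ _ (λ c → colSum-*ˡ (λ ψ → F (c ∷ ψ)) K))
        (sumFin-*ˡ (λ c → colSum (λ ψ → F (c ∷ ψ))) K)

colSum-sumFin : ∀ {n ℓ m} (F : Fin m → Colouring n ℓ → ℕ) →
  colSum (λ ψ → sumFin (λ v → F v ψ)) ≡ sumFin (λ v → colSum (F v))
colSum-sumFin {zero}  F = refl
colSum-sumFin {suc n} F =
  trans (sumFin-cong _ _ (λ c → colSum-sumFin (λ v ψ → F v (c ∷ ψ))))
        (sumFin-swap (λ c v → colSum (λ ψ → F v (c ∷ ψ))))

-- Independence of the colours: the total weight of a product of per-vertex
-- weights is the product of the per-vertex totals.
colSum-prod : ∀ {n ℓ} (w : Fin n → Fin ℓ → ℕ) →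
  colSum (λ ψ → prodFin (λ u → w u (lookup ψ u))) ≡ prodFin (λ u → sumFin (w u))
colSum-prod {zero}  w = refl
colSum-prod {suc n} w = begin
    sumFin (λ c → colSum (λ ψ → w fzero c * rest ψ))
  ≡⟨ sumFin-cong _ _ (λ c → colSum-*ˡ rest (w fzero c)) ⟩
    sumFin (λ c → w fzero c * colSum rest)
  ≡⟨ sumFin-*ʳ (w fzero) (colSum rest) ⟩
    sumFin (w fzero) * colSum rest
  ≡⟨ cong (sumFin (w fzero) *_) (colSum-prod (λ u → w (fsuc u))) ⟩
    sumFin (w fzero) * prodFin (λ u → sumFin (w (fsuc u)))
  ∎
  where open ≡-Reasoning
        rest : Colouring n _ → ℕ
        rest ψ = prodFin (λ u → w (fsuc u) (lookup ψ u))

colSum-const : ∀ n ℓ → colSum {n} {ℓ} (λ _ → 1) ≡ ℓ ^ n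
colSum-const zero    ℓ = refl
colSum-const (suc n) ℓ = trans (sumFin-cong {ℓ} _ (λ _ → ℓ ^ n) (λ _ → colSum-const n ℓ))
                               (sumFin-const ℓ (ℓ ^ n))

concatFin : ∀ {ℓ} {A : Set} → (Fin ℓ → List A) → List A
concatFin {zero}  f = []ₗ
concatFin {suc ℓ} f = f fzero ++ concatFin (λ i → f (fsuc i))

length-concatFin : ∀ {ℓ} {A : Set} (f : Fin ℓ → List A) →
  length (concatFin f) ≡ sumFin (λ i → length (f i))
length-concatFin {zero}  f = refl
length-concatFin {suc ℓ} f =
  trans (length-++ (f fzero)) (cong (length (f fzero) +_) (length-concatFin (λ i → f (fsuc i))))

∈-concatFin : ∀ {ℓ} {A : Set} (f : Fin ℓ → List A) i {x} → x ∈ f i → x ∈ concatFin f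
∈-concatFin f fzero    m = ∈-++⁺ˡ m
∈-concatFin f (fsuc i) m = ∈-++⁺ʳ (f fzero) (∈-concatFin (λ i → f (fsuc i)) i m)

select : ∀ {n ℓ} → (Colouring n ℓ → Bool) → List (Colouring n ℓ)
select {zero}  p = if p [] then [] ∷ₗ []ₗ else []ₗ
select {suc n} p = concatFin (λ c → map (c ∷_) (select (λ ψ → p (c ∷ ψ))))

length-select : ∀ {n ℓ} (p : Colouring n ℓ → Bool) → length (select p) ≡ colSum (λ ψ → ind (p ψ))
length-select {zero} p with p []
... | true  = refl
... | false = refl
length-select {suc n} p =
  trans (length-concatFin (λ c → map (c ∷_) (select (λ ψ → p (c ∷ ψ)))))
        (sumFin-cong _ _ (λ c → trans (length-map (c ∷_) (select (λ ψ → p (c ∷ ψ))))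
                                      (length-select (λ ψ → p (c ∷ ψ)))))

∈-select : ∀ {n ℓ} (p : Colouring n ℓ → Bool) ψ → p ψ ≡ true → ψ ∈ select p
∈-select {zero}  p [] e rewrite e = here refl
∈-select {suc n} p (c ∷ ψ) e =
  ∈-concatFin (λ c → map (c ∷_) (select (λ ψ → p (c ∷ ψ)))) c (∈-map⁺ (c ∷_) (∈-select _ ψ e))

∉-select : ∀ {n ℓ} (p : Colouring n ℓ → Bool) ψ → ψ ∉ select p → p ψ ≡ false
∉-select p ψ ψ∉ with p ψ in e
... | true  = ⊥-elim (ψ∉ (∈-select p ψ e))
... | false = refl

-- Every event holds with high probability when n ≤ 1 (then n^(-p/q) ≥ 1).
withProb-small : ∀ {p q} n ℓ (P : Colouring n ℓ → Set) → n ≤ 1 → WithProb≥1-n^-[ p / q ] n ℓ P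
withProb-small {p} {q} n ℓ P n≤1 =
  select (λ _ → true) , bound , λ ψ ψ∉ → ⊥-elim (ψ∉ (∈-select (λ _ → true) ψ refl))
  where
  everything : length (select {n} {ℓ} (λ _ → true)) ≡ ℓ ^ n
  everything = trans (length-select {n} {ℓ} (λ _ → true)) (colSum-const n ℓ)
  n^p≤1 : n ^ p ≤ 1
  n^p≤1 = ≤-trans (^-monoˡ-≤ p n≤1) (≤-reflexive (^-zeroˡ p))
  bound : length (select {n} {ℓ} (λ _ → true)) ^ q * n ^ p ≤ (ℓ ^ n) ^ q
  bound rewrite everything = ≤-trans (*-monoʳ-≤ ((ℓ ^ n) ^ q) n^p≤1) (≤-reflexive (*-identityʳ _))

-- An event that always holds (the exponent q must be positive, as 0^0 = 1).
withProb-always : ∀ {p q} n ℓ (P : Colouring n ℓ → Set) → (∀ ψ → P ψ) → WithProb≥1-n^-[ p / suc q ] n ℓ P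
withProb-always n ℓ P h = []ₗ , z≤n , λ ψ _ → h ψ

withProb-map : ∀ {p q n ℓ} {P Q : Colouring n ℓ → Set} → (∀ ψ → P ψ → Q ψ) →
  WithProb≥1-n^-[ p / q ] n ℓ P → WithProb≥1-n^-[ p / q ] n ℓ Q
withProb-map f (B , b , h) = B , b , λ ψ ψ∉ → f ψ (h ψ ψ∉)

withProb-union : ∀ {p q n ℓ m} (bad : Fin m → Colouring n ℓ → Bool) →
  (∀ j → (m * colSum (λ ψ → ind (bad j ψ))) ^ suc q * n ^ p ≤ (ℓ ^ n) ^ suc q) →
  WithProb≥1-n^-[ p / suc q ] n ℓ (λ ψ → ∀ j → bad j ψ ≡ false)
withProb-union {p} {q} {n} {ℓ} {zero} bad _ = withProb-always {p} {q} n ℓ _ (λ ψ ())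
withProb-union {p} {q} {n} {ℓ} {suc N} bad hb = B , bound , good
  where
  anyBad : Colouring n ℓ → Bool
  anyBad ψ = anyFin (λ j → bad j ψ)
  B = select anyBad
  size : Fin (suc N) → ℕ
  size j = colSum (λ ψ → ind (bad j ψ))
  jmax = proj₁ (argmax size)
  lenB : length B ≤ suc N * size jmax
  lenB = begin
      length B                                   ≡⟨ length-select anyBad ⟩
      colSum (λ ψ → ind (anyBad ψ))              ≤⟨ colSum-mono _ _ (λ ψ → anyFin-ind (λ j → bad j ψ)) ⟩
      colSum (λ ψ → sumFin (λ j → ind (bad j ψ))) ≡⟨ colSum-sumFin (λ j ψ → ind (bad j ψ)) ⟩
      sumFin size                                ≤⟨ sumFin-≤max size (size jmax) (proj₂ (argmax size)) ⟩
      suc N * size jmax                          ∎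
    where open ≤-Reasoning
  bound : length B ^ suc q * n ^ p ≤ (ℓ ^ n) ^ suc q
  bound = ≤-trans (*-monoˡ-≤ (n ^ p) (^-monoˡ-≤ (suc q) lenB)) (hb jmax)
  good : ∀ ψ → ψ ∉ B → ∀ j → bad j ψ ≡ false
  good ψ ψ∉ = anyFin-false (λ j → bad j ψ) (∉-select anyBad ψ ψ∉)

-- A κ-degenerate graph has an injective ranking in which every
-- vertex has at most κ forward neighbours (repeatedly remove a vertex of
-- minimum degree and give it the smallest rank).

Forward : ∀ {n} → Graph n → (Fin n → ℕ) → Fin n → Fin n → Bool
Forward G r v u = adj G v u ∧ ⌊ r v <? r u ⌋

RankingOn : ∀ {n} → Graph n → ℕ → Subset n → Set
RankingOn {n} G κ S =
  Σ (Fin n → ℕ) λ r → (∀ u v → S u ≡ true → S v ≡ true → r u ≡ r v → u ≡ v)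
                    × (∀ v → S v ≡ true → count (λ u → S u ∧ Forward G r v u) ≤ κ)

_∖[_] : ∀ {n} → Subset n → Fin n → Subset n
(S ∖[ v ]) u = S u ∧ not ⌊ u Fin.≟ v ⌋

∖-keeps : ∀ {n} (S : Subset n) {v} u → S u ≡ true → ⌊ u Fin.≟ v ⌋ ≡ false → (S ∖[ v ]) u ≡ true
∖-keeps S u su e rewrite su | e = refl

count-∖ : ∀ {n} (S : Subset n) v → S v ≡ true → suc (count (S ∖[ v ])) ≤ count S
count-∖ S v sv = begin
    suc (count (S ∖[ v ]))                       ≡⟨ +-comm 1 _ ⟩
    count (S ∖[ v ]) + 1                         ≤⟨ +-monoʳ-≤ (count (S ∖[ v ])) (count-pos _ v v∈) ⟩
    count (S ∖[ v ]) + count (λ u → S u ∧ ≟v u)  ≡⟨ +-comm (count (S ∖[ v ])) _ ⟩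
    count (λ u → S u ∧ ≟v u) + count (S ∖[ v ])  ≡⟨ count-split S ≟v ⟩
    count S                                      ∎
  where open ≤-Reasoning
        ≟v : Fin _ → Bool
        ≟v u = ⌊ u Fin.≟ v ⌋
        v∈ : (S v ∧ ≟v v) ≡ true
        v∈ = ∧-i sv (isYes-true (v Fin.≟ v) refl)

extend-ranking : ∀ {n} (G : Graph n) κ (S : Subset n) v₀ → degIn G S v₀ ≤ κ →
                 RankingOn G κ (S ∖[ v₀ ]) → RankingOn G κ S
extend-ranking G κ S v₀ deg≤ (r' , inj' , fwd') = r , inj , fwd
  where
  r : Fin _ → ℕ
  r u = if ⌊ u Fin.≟ v₀ ⌋ then 0 else suc (r' u)
  inj : ∀ u v → S u ≡ true → S v ≡ true → r u ≡ r v → u ≡ v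
  inj u v su sv e with ⌊ u Fin.≟ v₀ ⌋ in eu | ⌊ v Fin.≟ v₀ ⌋ in ev
  ... | true  | true  = trans (isYes-sound (u Fin.≟ v₀) eu) (sym (isYes-sound (v Fin.≟ v₀) ev))
  ... | false | false = inj' u v (∖-keeps S u su eu) (∖-keeps S v sv ev) (suc-injective e)
  rank-v₀ : ∀ u → ⌊ u Fin.≟ v₀ ⌋ ≡ true → r u ≡ 0
  rank-v₀ u e = cong (if_then 0 else suc (r' u)) e
  rank-other : ∀ u → ⌊ u Fin.≟ v₀ ⌋ ≡ false → r u ≡ suc (r' u)
  rank-other u e = cong (if_then 0 else suc (r' u)) e
  -- a forward neighbour u of v ≠ v₀ is not v₀ (which has rank 0) and stays forward
  forward-∖ : ∀ v u → ⌊ v Fin.≟ v₀ ⌋ ≡ false → (S u ∧ Forward G r v u) ≡ true →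
              ((S ∖[ v₀ ]) u ∧ Forward G r' v u) ≡ true
  forward-∖ v u ev h = go _ refl
    where
    rv<ru : r v < r u
    rv<ru = isYes-sound (r v <? r u) (∧-r {adj G v u} (∧-r {S u} h))
    go : (b : Bool) → ⌊ u Fin.≟ v₀ ⌋ ≡ b → ((S ∖[ v₀ ]) u ∧ Forward G r' v u) ≡ true
    go true  eu with () ← subst (r v <_) (rank-v₀ u eu) rv<ru
    go false eu = ∧-i (∖-keeps S u (∧-l h) eu)
                      (∧-i (∧-l (∧-r {S u} h))
                           (isYes-true (r' v <? r' u) (≤-pred (subst₂ _<_ (rank-other v ev) (rank-other u eu) rv<ru))))
  fwd : ∀ v → S v ≡ true → count (λ u → S u ∧ Forward G r v u) ≤ κ
  fwd v sv = go _ refl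
    where
    go : (b : Bool) → ⌊ v Fin.≟ v₀ ⌋ ≡ b → count (λ u → S u ∧ Forward G r v u) ≤ κ
    go true  ev = ≤-trans (count-mono _ _ neighbour) deg≤
      where neighbour : ∀ u → (S u ∧ Forward G r v u) ≡ true → (S u ∧ adj G v₀ u) ≡ true
            neighbour u h = ∧-i (∧-l h) (subst (λ w → adj G w u ≡ true) (isYes-sound (v Fin.≟ v₀) ev)
                                               (∧-l (∧-r {S u} h)))
    go false ev = ≤-trans (count-mono _ _ (λ u → forward-∖ v u ev)) (fwd' v (∖-keeps S v sv ev))

ranking-on : ∀ {n} (G : Graph n) κ → DegenerateOn G allV κ →
             ∀ size (S : Subset n) → count S ≤ size → RankingOn G κ S
ranking-on G κ D size S |S|≤ with anyFin S in nonempty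
... | false = (λ _ → 0) , (λ u _ su → ⊥-elim (empty u su)) , (λ v sv → ⊥-elim (empty v sv))
  where empty : ∀ u → S u ≡ true → ⊥
        empty u su with () ← trans (sym su) (anyFin-false S nonempty u)
ranking-on G κ D zero S |S|≤ | true with anyFin-true S nonempty
... | w , sw with () ← ≤-trans (count-pos S w sw) |S|≤
ranking-on G κ D (suc size) S |S|≤ | true with D S (λ _ _ → refl) (anyFin-true S nonempty)
... | v₀ , sv₀ , deg≤ =
  extend-ranking G κ S v₀ deg≤
    (ranking-on G κ D size (S ∖[ v₀ ]) (≤-pred (≤-trans (count-∖ S v₀ sv₀) |S|≤)))

degeneracy-ranking : ∀ {n} (G : Graph n) κ → DegenerateOn G allV κ →
  Σ (Fin n → ℕ) λ r → (∀ u v → r u ≡ r v → u ≡ v) × (∀ v → count (Forward G r v) ≤ κ)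
degeneracy-ranking {n} G κ D with ranking-on G κ D n allV (count≤n allV)
... | r , inj , fwd = r , (λ u v → inj u v refl refl) , (λ v → fwd v refl)

argmin-on : ∀ {n} (f : Fin n → ℕ) (S : Subset n) → (∃ λ w → S w ≡ true) →
            ∃ λ u → S u ≡ true × (∀ x → S x ≡ true → f u ≤ f x)
argmin-on f S (w , sw) with least Attained (λ t → anyFin (hits t) BoolP.≟ true) (f w) (attained w sw)
  where
  hits : ℕ → Fin _ → Bool
  hits t u = S u ∧ ⌊ f u ≟ t ⌋
  Attained : ℕ → Set
  Attained t = anyFin (hits t) ≡ true
  attained : ∀ x → S x ≡ true → Attained (f x)
  attained x sx = anyFin-intro _ x (∧-i sx (isYes-true (f x ≟ f x) refl))
... | t , at , below with anyFin-true _ at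
...   | u , hu = u , ∧-l hu , minimal
  where
  fu≡t : f u ≡ t
  fu≡t = isYes-sound (f u ≟ t) (∧-r {S u} hu)
  minimal : ∀ x → S x ≡ true → f u ≤ f x
  minimal x sx with f u ≤? f x
  ... | yes p = p
  ... | no ¬p = ⊥-elim (below (f x) (subst (f x <_) fu≡t (≰⇒> ¬p))
                              (anyFin-intro _ x (∧-i sx (isYes-true (f x ≟ f x) refl))))

adj-distinct : ∀ {n} (G : Graph n) u v → adj G u v ≡ true → u ≢ v
adj-distinct G u .u e refl with () ← trans (sym e) (irrefl G u)

oriented : ∀ {n} → (Fin n → ℕ) → (Fin n → Fin n → Bool) → ℕ
oriented a X = sumFin (λ u → sumFin (λ v → ind (⌊ a u <? a v ⌋ ∧ X u v)))

oriented-twice : ∀ {n} (a : Fin n → ℕ) (X : Fin n → Fin n → Bool) →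
  (∀ u v → a u ≡ a v → u ≡ v) → (∀ u v → X u v ≡ X v u) → (∀ u v → X u v ≡ true → u ≢ v) →
  oriented a X + oriented a X ≡ sumFin (λ u → sumFin (λ v → ind (X u v)))
oriented-twice {n} a X a-inj X-sym X-irr = begin
    oriented a X + oriented a X
  ≡⟨ cong (oriented a X +_) (sumFin-swap term) ⟩
    oriented a X + sumFin (λ u → sumFin (λ v → term v u))
  ≡⟨ sym (sumFin-+ {n} _ _) ⟩
    sumFin (λ u → sumFin (λ v → term u v) + sumFin (λ v → term v u))
  ≡⟨ sumFin-cong {n} _ _ (λ u → sym (sumFin-+ {n} _ _)) ⟩
    sumFin (λ u → sumFin (λ v → term u v + term v u))
  ≡⟨ sumFin-cong {n} _ _ (λ u → sumFin-cong {n} _ _ (λ v → one-orientation u v)) ⟩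
    sumFin (λ u → sumFin (λ v → ind (X u v)))
  ∎
  where
  open ≡-Reasoning
  term : Fin n → Fin n → ℕ
  term u v = ind (⌊ a u <? a v ⌋ ∧ X u v)
  one-orientation : ∀ u v → term u v + term v u ≡ ind (X u v)
  one-orientation u v rewrite X-sym v u with X u v in e
  ... | false rewrite BoolP.∧-zeroʳ ⌊ a u <? a v ⌋ | BoolP.∧-zeroʳ ⌊ a v <? a u ⌋ = refl
  ... | true  rewrite BoolP.∧-identityʳ ⌊ a u <? a v ⌋ | BoolP.∧-identityʳ ⌊ a v <? a u ⌋ =
    <-xor (a u <? a v) (a v <? a u) (λ eq → X-irr u v e (a-inj u v eq))

oriented-indep : ∀ {n} (a b : Fin n → ℕ) (X : Fin n → Fin n → Bool) →
  (∀ u v → a u ≡ a v → u ≡ v) → (∀ u v → b u ≡ b v → u ≡ v) →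
  (∀ u v → X u v ≡ X v u) → (∀ u v → X u v ≡ true → u ≢ v) →
  oriented a X ≡ oriented b X
oriented-indep a b X a-inj b-inj X-sym X-irr =
  +-cancel-double (trans (oriented-twice a X a-inj X-sym X-irr) (sym (oriented-twice b X b-inj X-sym X-irr)))
  where +-cancel-double : ∀ {x y} → x + x ≡ y + y → x ≡ y
        +-cancel-double {x} {y} e = *-cancelˡ-≡ x y 2 (trans (cong (x +_) (+-identityʳ x))
                                                     (trans e (sym (cong (y +_) (+-identityʳ y)))))

module Ranked {n} (G : Graph n) (r : Fin n → ℕ) (r-inj : ∀ u v → r u ≡ r v → u ≡ v) where

  monoForward : ∀ {ℓ} → Colouring n ℓ → Fin n → ℕ
  monoForward ψ v = count (λ u → Forward G r v u ∧ ⌊ lookup ψ u Fin.≟ lookup ψ v ⌋)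

  -- If every vertex has at most J same-coloured forward neighbours then every
  -- colour class is J-degenerate: in any nonempty S inside a class, the vertex
  -- of least rank has all its S-neighbours in front of it and of its colour.
  classes-degenerate : ∀ {ℓ} (ψ : Colouring n ℓ) J → (∀ v → monoForward ψ v ≤ J) →
                       ∀ i → DegenerateOn G (colourClass ψ i) J
  classes-degenerate ψ J fwd≤ i S S⊆ nonempty with argmin-on r S nonempty
  ... | u , su , u-least = u , su , ≤-trans (count-mono _ _ forward-mono) (fwd≤ u)
    where
    forward-mono : ∀ x → (S x ∧ adj G u x) ≡ true →
                   (Forward G r u x ∧ ⌊ lookup ψ x Fin.≟ lookup ψ u ⌋) ≡ true
    forward-mono x h = ∧-i (∧-i ux (isYes-true (r u <? r x) ru<rx))
                           (isYes-true (_ Fin.≟ _) (trans (colour x sx) (sym (colour u su))))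
      where
      sx = ∧-l {S x} h
      ux = ∧-r {S x} h
      colour : ∀ y → S y ≡ true → lookup ψ y ≡ i
      colour y sy = isYes-sound (lookup ψ y Fin.≟ i) (S⊆ y sy)
      ru<rx : r u < r x
      ru<rx = ≤∧≢⇒< (u-least x sx) (λ e → adj-distinct G u x ux (r-inj u x e))

  -- The monochromatic edges, read as ordered pairs u < v, counted by
  -- orienting each one by the ranking instead.
  monoEdges≡sumForward : ∀ {ℓ} (ψ : Colouring n ℓ) → monoEdges G ψ ≡ sumFin (monoForward ψ)
  monoEdges≡sumForward ψ = begin
      monoEdges G ψ
    ≡⟨ sumFin-cong {n} _ _ (λ u → count≡sum {n} _) ⟩
      oriented Fin.toℕ X
    ≡⟨ oriented-indep Fin.toℕ r X (λ u v → FinP.toℕ-injective) r-inj X-sym X-irr ⟩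
      oriented r X
    ≡⟨ sumFin-cong {n} _ _ (λ v → sym (trans (count≡sum {n} _) (sumFin-cong {n} _ _ (λ u → cong ind (reorder v u))))) ⟩
      sumFin (monoForward ψ)
    ∎
    where
    open ≡-Reasoning
    X : Fin n → Fin n → Bool
    X u v = adj G u v ∧ ⌊ lookup ψ u Fin.≟ lookup ψ v ⌋
    X-sym : ∀ u v → X u v ≡ X v u
    X-sym u v = cong₂ _∧_ (adj-sym G u v) (≟-sym (lookup ψ u) (lookup ψ v))
    X-irr : ∀ u v → X u v ≡ true → u ≢ v
    X-irr u v e = adj-distinct G u v (∧-l e)
    reorder : ∀ v u → (Forward G r v u ∧ ⌊ lookup ψ u Fin.≟ lookup ψ v ⌋) ≡ (⌊ r v <? r u ⌋ ∧ X v u)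
    reorder v u rewrite ≟-sym (lookup ψ u) (lookup ψ v) with adj G v u | ⌊ r v <? r u ⌋
    ... | true  | true  = refl
    ... | true  | false = refl
    ... | false | true  = refl
    ... | false | false = refl

-- Weighting a colouring by
-- (1 + 1/m)^(#u ∈ F coloured like v) and using independence of the colours:
--   #{ψ : ≥ J vertices of F share v's colour} · (m+1)^J m^f ℓ^f
--     ≤ m^J · ℓ^n · (ℓm + 1)^f,                where f = |F|,
-- i.e.  Pr[≥ J] ≤ (m/(m+1))^J ((ℓm+1)/(ℓm))^f.

pow-shift : ∀ m J a b → J ≤ a → (m + 1) ^ J * m ^ (a + b) ≤ m ^ J * ((m + 1) ^ a * m ^ b)
pow-shift m J a b J≤a with m≤n⇒∃[o]m+o≡n J≤a
... | t , refl = begin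
    (m + 1) ^ J * m ^ (J + t + b)
  ≡⟨ cong ((m + 1) ^ J *_) (trans (^-distribˡ-+-* m (J + t) b) (cong (_* m ^ b) (^-distribˡ-+-* m J t))) ⟩
    (m + 1) ^ J * (m ^ J * m ^ t * m ^ b)
  ≤⟨ *-monoʳ-≤ ((m + 1) ^ J) (*-monoˡ-≤ (m ^ b) (*-monoʳ-≤ (m ^ J) (^-monoˡ-≤ t (m≤m+n m 1)))) ⟩
    (m + 1) ^ J * (m ^ J * (m + 1) ^ t * m ^ b)
  ≡⟨ swap ((m + 1) ^ J) (m ^ J) ((m + 1) ^ t) (m ^ b) ⟩
    m ^ J * ((m + 1) ^ J * (m + 1) ^ t * m ^ b)
  ≡⟨ cong (λ z → m ^ J * (z * m ^ b)) (sym (^-distribˡ-+-* (m + 1) J t)) ⟩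
    m ^ J * ((m + 1) ^ (J + t) * m ^ b) ∎
  where open ≤-Reasoning
        swap : ∀ A B C D → A * (B * C * D) ≡ B * (A * C * D)
        swap = solve-∀

module SameColourTail {n ℓ : ℕ} (F : Subset n) (v : Fin n) (v∉F : F v ≡ false) (m J : ℕ) where

  f = count F

  sameAs : Colouring n ℓ → Fin ℓ → ℕ
  sameAs ψ i = count (λ u → F u ∧ ⌊ lookup ψ u Fin.≟ i ⌋)

  Tail : Colouring n ℓ → Bool
  Tail ψ = ⌊ J ≤? sameAs ψ (lookup ψ v) ⌋

  TailAt : Colouring n ℓ → Fin ℓ → Bool
  TailAt ψ i = ⌊ lookup ψ v Fin.≟ i ⌋ ∧ ⌊ J ≤? sameAs ψ i ⌋

  weightF : Fin ℓ → Fin ℓ → ℕ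
  weightF i c = if ⌊ c Fin.≟ i ⌋ then m + 1 else m
  weightO : Fin ℓ → Fin n → Fin ℓ → ℕ
  weightO i u c = if ⌊ u Fin.≟ v ⌋ then (if ⌊ c Fin.≟ i ⌋ then 0 + ℓ else 0) else 1
  weight : Fin ℓ → Fin n → Fin ℓ → ℕ
  weight i u c = if F u then weightF i c else weightO i u c

  weight-total : ∀ i u → sumFin (weight i u) ≡ (if F u then ℓ * m + 1 else ℓ)
  weight-total i u with F u
  ... | true = sumFin-bump i m 1
  ... | false with ⌊ u Fin.≟ v ⌋
  ...   | true  = trans (sumFin-bump i 0 ℓ) (cong (_+ ℓ) (*-zeroʳ ℓ))
  ...   | false = trans (sumFin-const ℓ 1) (*-identityʳ ℓ)

  weights-total : ∀ i → colSum (λ ψ → prodFin (λ u → weight i u (lookup ψ u))) * ℓ ^ f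
                        ≡ ℓ ^ n * (ℓ * m + 1) ^ f
  weights-total i = trans (cong (_* ℓ ^ f) (trans (colSum-prod (weight i)) (prodFin-cong _ _ (weight-total i))))
                          (prodFin-ifF F (ℓ * m + 1) ℓ)

  weight-large : ∀ ψ i → TailAt ψ i ≡ true →
                 ℓ * ((m + 1) ^ J * m ^ f) ≤ m ^ J * prodFin (λ u → weight i u (lookup ψ u))
  weight-large ψ i e = begin
      ℓ * ((m + 1) ^ J * m ^ f)
    ≡⟨ cong (λ z → ℓ * ((m + 1) ^ J * m ^ z)) (sym (count-split F Q)) ⟩
      ℓ * ((m + 1) ^ J * m ^ (a + b))
    ≤⟨ *-monoʳ-≤ ℓ (pow-shift m J a b J≤a) ⟩
      ℓ * (m ^ J * ((m + 1) ^ a * m ^ b))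
    ≡⟨ rotate ℓ (m ^ J) ((m + 1) ^ a * m ^ b) ⟩
      m ^ J * (((m + 1) ^ a * m ^ b) * ℓ)
    ≡⟨ cong (λ z → m ^ J * (z * ℓ)) (sym (prodFin-pow F Q (m + 1) m)) ⟩
      m ^ J * (prodFin onF * ℓ)
    ≡⟨ cong (λ z → m ^ J * (prodFin onF * z)) (sym (trans (prodFin-cong _ _ off-F) (prodFin-single v ℓ))) ⟩
      m ^ J * (prodFin onF * prodFin offF)
    ≡⟨ cong (m ^ J *_) (sym (prodFin-* {n} _ _)) ⟩
      m ^ J * prodFin (λ u → onF u * offF u)
    ≡⟨ cong (m ^ J *_) (prodFin-cong _ _ split) ⟩
      m ^ J * prodFin (λ u → weight i u (lookup ψ u)) ∎
    where
    open ≤-Reasoning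
    Q : Fin n → Bool
    Q u = ⌊ lookup ψ u Fin.≟ i ⌋
    a = count (λ u → F u ∧ Q u)
    b = count (λ u → F u ∧ not (Q u))
    J≤a : J ≤ a
    J≤a = isYes-sound (J ≤? a) (∧-r {⌊ lookup ψ v Fin.≟ i ⌋} e)
    ψv≡i : lookup ψ v ≡ i
    ψv≡i = isYes-sound (lookup ψ v Fin.≟ i) (∧-l e)
    rotate : ∀ x y z → x * (y * z) ≡ y * (z * x)
    rotate = solve-∀
    onF offF : Fin n → ℕ
    onF  u = if F u then (if Q u then m + 1 else m) else 1
    offF u = if F u then 1 else weightO i u (lookup ψ u)
    split : ∀ u → onF u * offF u ≡ weight i u (lookup ψ u)
    split u with F u
    ... | true  = *-identityʳ _
    ... | false = *-identityˡ _
    off-F : ∀ u → offF u ≡ (if ⌊ u Fin.≟ v ⌋ then ℓ else 1)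
    off-F u with ⌊ u Fin.≟ v ⌋ in e₁
    ... | true  with isYes-sound (u Fin.≟ v) e₁
    ...   | refl rewrite v∉F | isYes-true (lookup ψ v Fin.≟ i) ψv≡i = refl
    off-F u | false with F u
    ...   | true  = refl
    ...   | false = refl

  tailAt-bound : ∀ i → colSum (λ ψ → ind (TailAt ψ i)) * (ℓ * ((m + 1) ^ J * m ^ f)) * ℓ ^ f
                       ≤ m ^ J * (ℓ ^ n * (ℓ * m + 1) ^ f)
  tailAt-bound i = begin
      colSum (λ ψ → ind (TailAt ψ i)) * K * ℓ ^ f
    ≡⟨ cong (_* ℓ ^ f) (trans (*-comm _ K) (sym (colSum-*ˡ (λ ψ → ind (TailAt ψ i)) K))) ⟩
      colSum (λ ψ → K * ind (TailAt ψ i)) * ℓ ^ f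
    ≤⟨ *-monoˡ-≤ (ℓ ^ f) (colSum-mono _ _ pointwise) ⟩
      colSum (λ ψ → m ^ J * prodFin (λ u → weight i u (lookup ψ u))) * ℓ ^ f
    ≡⟨ cong (_* ℓ ^ f) (colSum-*ˡ {n} {ℓ} _ (m ^ J)) ⟩
      m ^ J * colSum (λ ψ → prodFin (λ u → weight i u (lookup ψ u))) * ℓ ^ f
    ≡⟨ trans (*-assoc (m ^ J) _ _) (cong (m ^ J *_) (weights-total i)) ⟩
      m ^ J * (ℓ ^ n * (ℓ * m + 1) ^ f) ∎
    where
    open ≤-Reasoning
    K = ℓ * ((m + 1) ^ J * m ^ f)
    pointwise : ∀ ψ → K * ind (TailAt ψ i) ≤ m ^ J * prodFin (λ u → weight i u (lookup ψ u))
    pointwise ψ with TailAt ψ i in e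
    ... | false = ≤-trans (≤-reflexive (*-zeroʳ K)) z≤n
    ... | true  = ≤-trans (≤-reflexive (*-identityʳ K)) (weight-large ψ i e)

  tail≤tailAt : ∀ ψ → ind (Tail ψ) ≤ sumFin (λ i → ind (TailAt ψ i))
  tail≤tailAt ψ = ≤-trans (≤-reflexive (cong (λ b → ind (b ∧ Tail ψ)) (sym (isYes-true (lookup ψ v Fin.≟ lookup ψ v) refl))))
                          (sumFin-≥ (λ i → ind (TailAt ψ i)) (lookup ψ v))

  tail-bound : .{{_ : NonZero ℓ}} →
    colSum (λ ψ → ind (Tail ψ)) * ((m + 1) ^ J * m ^ f * ℓ ^ f) ≤ m ^ J * (ℓ ^ n * (ℓ * m + 1) ^ f)
  tail-bound = *-cancelˡ-≤ ℓ (begin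
      ℓ * (colSum (λ ψ → ind (Tail ψ)) * ((m + 1) ^ J * m ^ f * ℓ ^ f))
    ≡⟨ regroup ℓ (colSum (λ ψ → ind (Tail ψ))) ((m + 1) ^ J * m ^ f) (ℓ ^ f) ⟩
      colSum (λ ψ → ind (Tail ψ)) * K * ℓ ^ f
    ≤⟨ *-monoˡ-≤ (ℓ ^ f) (*-monoˡ-≤ K
         (≤-trans (colSum-mono _ _ tail≤tailAt) (≤-reflexive (colSum-sumFin (λ i ψ → ind (TailAt ψ i)))))) ⟩
      sumFin (λ i → colSum (λ ψ → ind (TailAt ψ i))) * K * ℓ ^ f
    ≡⟨ trans (cong (_* ℓ ^ f) (sym (sumFin-*ʳ {ℓ} _ _))) (sym (sumFin-*ʳ {ℓ} _ _)) ⟩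
      sumFin (λ i → colSum (λ ψ → ind (TailAt ψ i)) * K * ℓ ^ f)
    ≤⟨ sumFin-≤max {ℓ} _ _ tailAt-bound ⟩
      ℓ * (m ^ J * (ℓ ^ n * (ℓ * m + 1) ^ f)) ∎)
    where open ≤-Reasoning
          K = ℓ * ((m + 1) ^ J * m ^ f)
          regroup : ∀ a b c d → a * (b * (c * d)) ≡ b * (a * c) * d
          regroup = solve-∀

^-distribʳ-* : ∀ x y k → (x * y) ^ k ≡ x ^ k * y ^ k
^-distribʳ-* x y zero = refl
^-distribʳ-* x y (suc k) = trans (cong (x * y *_) (^-distribʳ-* x y k)) (lem x y (x ^ k) (y ^ k))
  where lem : ∀ a b c d → a * b * (c * d) ≡ a * c * (b * d)
        lem = solve-∀

2^-reflects-≤ : ∀ a b → 2 ^ a ≤ 2 ^ b → a ≤ b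
2^-reflects-≤ a b h with a ≤? b
... | yes p = p
... | no np = ⊥-elim (<⇒≱ (^-monoʳ-< 2 (s≤s (s≤s z≤n)) (≰⇒> np)) h)

square-reflects-≤ : ∀ x y → x * x ≤ y * y → x ≤ y
square-reflects-≤ x y h with x ≤? y
... | yes p = p
... | no np = ⊥-elim (<⇒≱ (*-mono-< (≰⇒> np) (≰⇒> np)) h)

≤-/ : ∀ a b n .{{_ : NonZero n}} → a * n ≤ b → a ≤ b / n
≤-/ a b n h = subst (_≤ b / n) (m*n/n≡m a n) (/-monoˡ-≤ n h)

binomial-upper : ∀ N j → j ≤ N → (N + 1) ^ j * (N * N) ≤ N ^ j * (N * N + j * N + j * j)
binomial-upper N zero _ = ≤-reflexive (cong (λ z → 1 * z) (sym (trans (+-identityʳ (N * N + 0)) (+-identityʳ (N * N)))))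
binomial-upper N (suc j) sj≤N with m≤n⇒∃[o]m+o≡n sj≤N
... | t , refl = begin
    (M + 1) ^ suc j * (M * M)
  ≡⟨ *-assoc (M + 1) ((M + 1) ^ j) (M * M) ⟩
    (M + 1) * ((M + 1) ^ j * (M * M))
  ≤⟨ *-monoʳ-≤ (M + 1) (binomial-upper M j (≤-trans (n≤1+n j) sj≤N)) ⟩
    (M + 1) * (M ^ j * (M * M + j * M + j * j))
  ≡⟨ lem (M + 1) (M ^ j) (M * M + j * M + j * j) ⟩
    M ^ j * ((M + 1) * (M * M + j * M + j * j))
  ≤⟨ *-monoʳ-≤ (M ^ j) (≤-trans (m≤m+n _ _) (≤-reflexive (binomial-expand j t))) ⟩
    M ^ j * (M * (M * M + suc j * M + suc j * suc j))
  ≡⟨ sym (lem M (M ^ j) _) ⟩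
    M * (M ^ j * (M * M + suc j * M + suc j * suc j))
  ≡⟨ sym (*-assoc M (M ^ j) (M * M + suc j * M + suc j * suc j)) ⟩
    M ^ suc j * (M * M + suc j * M + suc j * suc j) ∎
  where open ≤-Reasoning
        M = suc j + t
        lem : ∀ a b c → a * (b * c) ≡ b * (a * c)
        lem = solve-∀
        binomial-expand : ∀ j t → (suc j + t + 1) * ((suc j + t) * (suc j + t) + j * (suc j + t) + j * j)
                                    + (2 * j + 1 + t + t * j)
                                  ≡ (suc j + t) * ((suc j + t) * (suc j + t) + suc j * (suc j + t) + suc j * suc j)
        binomial-expand = solve-∀

bernoulli : ∀ N j → N ^ j * (N + j) ≤ (N + 1) ^ j * N
bernoulli N zero = ≤-reflexive (cong (1 *_) (+-identityʳ N))
bernoulli N (suc j) = begin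
    N * N ^ j * (N + suc j)
  ≡⟨ lem1 N (N ^ j) j ⟩
    N ^ j * (N + j) * N + N ^ j * N
  ≤⟨ +-monoʳ-≤ (N ^ j * (N + j) * N) (*-monoʳ-≤ (N ^ j) (m≤m+n N j)) ⟩
    N ^ j * (N + j) * N + N ^ j * (N + j)
  ≡⟨ lem2 (N ^ j * (N + j)) N ⟩
    (N + 1) * (N ^ j * (N + j))
  ≤⟨ *-monoʳ-≤ (N + 1) (bernoulli N j) ⟩
    (N + 1) * ((N + 1) ^ j * N)
  ≡⟨ sym (*-assoc (N + 1) _ N) ⟩
    (N + 1) ^ suc j * N ∎
  where open ≤-Reasoning
        lem1 : ∀ N P j → N * P * (N + suc j) ≡ P * (N + j) * N + P * N
        lem1 = solve-∀
        lem2 : ∀ A N → A * N + A ≡ (N + 1) * A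
        lem2 = solve-∀

bernoulli-2 : ∀ m → 1 ≤ m → 2 * m ^ m ≤ (m + 1) ^ m
bernoulli-2 (suc m') _ = *-cancelʳ-≤ (2 * M ^ M) ((M + 1) ^ M) M (begin
    2 * M ^ M * M ≡⟨ lem (M ^ M) M ⟩
    M ^ M * (M + M) ≤⟨ bernoulli M M ⟩
    (M + 1) ^ M * M ∎)
  where open ≤-Reasoning
        M = suc m'
        lem : ∀ P M → 2 * P * M ≡ P * (M + M)
        lem = solve-∀

ratio-power-ℓ : ∀ m ℓ → 1 ≤ m → 1 ≤ ℓ → (m * ℓ + 1) ^ ℓ * (m * m * m) ≤ (m * ℓ) ^ ℓ * ((m + 1) * (m * m + 1))
ratio-power-ℓ m@(suc _) ℓ@(suc _) _ _ = *-cancelʳ-≤ _ _ (ℓ * ℓ) (begin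
    (m * ℓ + 1) ^ ℓ * (m * m * m) * (ℓ * ℓ)
  ≡⟨ lem1 ((m * ℓ + 1) ^ ℓ) m ℓ ⟩
    m * ((m * ℓ + 1) ^ ℓ * (m * ℓ * (m * ℓ)))
  ≤⟨ *-monoʳ-≤ m (binomial-upper (m * ℓ) ℓ (m≤n*m ℓ m)) ⟩
    m * ((m * ℓ) ^ ℓ * (m * ℓ * (m * ℓ) + ℓ * (m * ℓ) + ℓ * ℓ))
  ≤⟨ ≤-trans (m≤m+n _ ((m * ℓ) ^ ℓ * (ℓ * ℓ))) (≤-reflexive (lem2 ((m * ℓ) ^ ℓ) m ℓ)) ⟩
    (m * ℓ) ^ ℓ * ((m + 1) * (m * m + 1)) * (ℓ * ℓ) ∎)
  where open ≤-Reasoning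
        lem1 : ∀ X m ℓ → X * (m * m * m) * (ℓ * ℓ) ≡ m * (X * (m * ℓ * (m * ℓ)))
        lem1 = solve-∀
        lem2 : ∀ Y m ℓ → m * (Y * (m * ℓ * (m * ℓ) + ℓ * (m * ℓ) + ℓ * ℓ)) + Y * (ℓ * ℓ) ≡ Y * ((m + 1) * (m * m + 1)) * (ℓ * ℓ)
        lem2 = solve-∀

ratio-power-short : ∀ m j → suc j ≤ m → (m * m + 1) ^ j * m ≤ (m * m) ^ j * (m + 1)
ratio-power-short m j sj≤m with m≤n⇒∃[o]m+o≡n sj≤m
... | t , refl = *-cancelʳ-≤ _ _ (M * M * M) (begin
    (M * M + 1) ^ j * M * (M * M * M)
  ≡⟨ lem1 ((M * M + 1) ^ j) M ⟩
    (M * M + 1) ^ j * (M * M * (M * M))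
  ≤⟨ binomial-upper (M * M) j (≤-trans (n≤1+n j) (≤-trans sj≤m (m≤m*n M M))) ⟩
    (M * M) ^ j * (M * M * (M * M) + j * (M * M) + j * j)
  ≤⟨ *-monoʳ-≤ ((M * M) ^ j) (≤-trans (m≤m+n _ _) (≤-reflexive (poly j t))) ⟩
    (M * M) ^ j * (M * M * M * (M + 1))
  ≡⟨ lem2 ((M * M) ^ j) M ⟩
    (M * M) ^ j * (M + 1) * (M * M * M) ∎)
  where open ≤-Reasoning
        M = suc j + t
        lem1 : ∀ X M → X * M * (M * M * M) ≡ X * (M * M * (M * M))
        lem1 = solve-∀
        lem2 : ∀ Y M → Y * (M * M * M * (M + 1)) ≡ Y * (M + 1) * (M * M * M)
        lem2 = solve-∀
        poly : ∀ j t → (suc j + t) * (suc j + t) * ((suc j + t) * (suc j + t)) + j * ((suc j + t) * (suc j + t)) + j * j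
                       + (j * j * t + 2 * j * ((1 + t) * (1 + t)) + (1 + t) * (1 + t) * (1 + t))
                     ≡ (suc j + t) * (suc j + t) * (suc j + t) * (suc j + t + 1)
        poly = solve-∀

ratio-power-blocks : ∀ h a → (suc h * suc h + 1) ^ (a * h) * suc h ^ a ≤ (suc h * suc h) ^ (a * h) * (suc h + 1) ^ a
ratio-power-blocks h zero = ≤-refl
ratio-power-blocks h (suc a) = begin
    X ^ (h + a * h) * (m * m ^ a)
  ≡⟨ cong (_* (m * m ^ a)) (^-distribˡ-+-* X h (a * h)) ⟩
    X ^ h * X ^ (a * h) * (m * m ^ a)
  ≡⟨ lem (X ^ h) (X ^ (a * h)) m (m ^ a) ⟩
    (X ^ h * m) * (X ^ (a * h) * m ^ a)
  ≤⟨ *-mono-≤ (ratio-power-short m h ≤-refl) (ratio-power-blocks h a) ⟩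
    (Y ^ h * (m + 1)) * (Y ^ (a * h) * (m + 1) ^ a)
  ≡⟨ sym (lem (Y ^ h) (Y ^ (a * h)) (m + 1) ((m + 1) ^ a)) ⟩
    Y ^ h * Y ^ (a * h) * ((m + 1) * (m + 1) ^ a)
  ≡⟨ cong (_* ((m + 1) * (m + 1) ^ a)) (sym (^-distribˡ-+-* Y h (a * h))) ⟩
    Y ^ (h + a * h) * ((m + 1) * (m + 1) ^ a) ∎
  where open ≤-Reasoning
        m = suc h
        X = m * m + 1
        Y = m * m
        lem : ∀ a b c d → a * b * (c * d) ≡ (a * c) * (b * d)
        lem = solve-∀

ratio-power-long : ∀ h E .{{_ : NonZero h}} → (suc h * suc h + 1) ^ E * suc h ^ suc (E / h)
                                  ≤ (suc h * suc h) ^ E * (suc h + 1) ^ suc (E / h)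
ratio-power-long h E = begin
    X ^ E * (m * m ^ a)
  ≡⟨ cong (λ z → X ^ z * (m * m ^ a)) eE ⟩
    X ^ (r + a * h) * (m * m ^ a)
  ≡⟨ cong (_* (m * m ^ a)) (^-distribˡ-+-* X r (a * h)) ⟩
    X ^ r * X ^ (a * h) * (m * m ^ a)
  ≡⟨ lem (X ^ r) (X ^ (a * h)) m (m ^ a) ⟩
    (X ^ r * m) * (X ^ (a * h) * m ^ a)
  ≤⟨ *-mono-≤ (ratio-power-short m r (s≤s (<⇒≤ (m%n<n E h)))) (ratio-power-blocks h a) ⟩
    (Y ^ r * (m + 1)) * (Y ^ (a * h) * (m + 1) ^ a)
  ≡⟨ sym (lem (Y ^ r) (Y ^ (a * h)) (m + 1) ((m + 1) ^ a)) ⟩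
    Y ^ r * Y ^ (a * h) * ((m + 1) * (m + 1) ^ a)
  ≡⟨ cong (_* ((m + 1) * (m + 1) ^ a)) (sym (^-distribˡ-+-* Y r (a * h))) ⟩
    Y ^ (r + a * h) * ((m + 1) * (m + 1) ^ a)
  ≡⟨ cong (λ z → Y ^ z * ((m + 1) * (m + 1) ^ a)) (sym eE) ⟩
    Y ^ E * ((m + 1) * (m + 1) ^ a) ∎
  where open ≤-Reasoning
        m = suc h
        X = m * m + 1
        Y = m * m
        a = E / h
        r = E % h
        eE : E ≡ r + a * h
        eE = m≡m%n+[m/n]*n E h
        lem : ∀ a b c d → a * b * (c * d) ≡ (a * c) * (b * d)
        lem = solve-∀

-- The cost of the f ≤ ℓE forward neighbours in the tail bound is paid by
-- E + E/h + 1 extra units of J: with m = h + 1 and E = μ + 1,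
--   (1 + 1/(mℓ))^(ℓE) ≤ (1 + 1/m)^(E + E/h + 1).
colour-ratio-bound : ∀ h ℓ μ .{{_ : NonZero h}} → 1 ≤ ℓ →
  (suc h * ℓ + 1) ^ (ℓ * suc μ) * suc h ^ (suc μ + suc (suc μ / h))
    ≤ (suc h * ℓ) ^ (ℓ * suc μ) * (suc h + 1) ^ (suc μ + suc (suc μ / h))
colour-ratio-bound h ℓ μ 1≤ℓ = *-cancelˡ-≤ (Y ^ E) {{m^n≢0 Y E}} (begin
    Y ^ E * (P ^ K * m ^ (E + suc a))
  ≡⟨ cong (λ z → Y ^ E * (P ^ K * z)) (^-distribˡ-+-* m E (suc a)) ⟩
    Y ^ E * (P ^ K * (m ^ E * m ^ suc a))
  ≡⟨ lem1 (Y ^ E) (P ^ K) (m ^ E) (m ^ suc a) ⟩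
    (P ^ K * (Y ^ E * m ^ E)) * m ^ suc a
  ≡⟨ cong (_* m ^ suc a) eL ⟩
    (P ^ ℓ * (Y * m)) ^ E * m ^ suc a
  ≤⟨ *-monoˡ-≤ (m ^ suc a) (^-monoˡ-≤ E (ratio-power-ℓ m ℓ (s≤s z≤n) 1≤ℓ)) ⟩
    (Q ^ ℓ * ((m + 1) * (Y + 1))) ^ E * m ^ suc a
  ≡⟨ cong (_* m ^ suc a) eR ⟩
    (Q ^ K * ((m + 1) ^ E * (Y + 1) ^ E)) * m ^ suc a
  ≡⟨ lem2 (Q ^ K) ((m + 1) ^ E) ((Y + 1) ^ E) (m ^ suc a) ⟩
    (Q ^ K * (m + 1) ^ E) * ((Y + 1) ^ E * m ^ suc a)
  ≤⟨ *-monoʳ-≤ (Q ^ K * (m + 1) ^ E) (ratio-power-long h E) ⟩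
    (Q ^ K * (m + 1) ^ E) * (Y ^ E * (m + 1) ^ suc a)
  ≡⟨ lem3 (Q ^ K) ((m + 1) ^ E) (Y ^ E) ((m + 1) ^ suc a) ⟩
    Y ^ E * (Q ^ K * ((m + 1) ^ E * (m + 1) ^ suc a))
  ≡⟨ cong (λ z → Y ^ E * (Q ^ K * z)) (sym (^-distribˡ-+-* (m + 1) E (suc a))) ⟩
    Y ^ E * (Q ^ K * (m + 1) ^ (E + suc a)) ∎)
  where
  open ≤-Reasoning
  m = suc h
  E = suc μ
  K = ℓ * E
  a = E / h
  P = m * ℓ + 1
  Q = m * ℓ
  Y = m * m
  lem1 : ∀ a b c d → a * (b * (c * d)) ≡ (b * (a * c)) * d
  lem1 = solve-∀
  lem2 : ∀ a b c d → (a * (b * c)) * d ≡ (a * b) * (c * d)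
  lem2 = solve-∀
  lem3 : ∀ a b c d → (a * b) * (c * d) ≡ c * (a * (b * d))
  lem3 = solve-∀
  eL : P ^ K * (Y ^ E * m ^ E) ≡ (P ^ ℓ * (Y * m)) ^ E
  eL = sym (trans (^-distribʳ-* (P ^ ℓ) (Y * m) E)
         (cong₂ _*_ (^-*-assoc P ℓ E) (^-distribʳ-* Y m E)))
  eR : (Q ^ ℓ * ((m + 1) * (Y + 1))) ^ E ≡ Q ^ K * ((m + 1) ^ E * (Y + 1) ^ E)
  eR = trans (^-distribʳ-* (Q ^ ℓ) ((m + 1) * (Y + 1)) E)
         (cong₂ _*_ (^-*-assoc Q ℓ E) (^-distribʳ-* (m + 1) (Y + 1) E))

-- (m/(m+1))^(4T) ≤ n^(-5) once 4T ≥ 5Vm and n < 2^V, since (1 + 1/m)^m ≥ 2.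
tail-decay : ∀ m V T n → 1 ≤ m → m * (V * 5) ≤ T * 4 → n < 2 ^ V → n ^ 5 * m ^ (T * 4) ≤ (m + 1) ^ (T * 4)
tail-decay m V T n 1≤m le n< with m≤n⇒∃[o]m+o≡n le
... | r , e = begin
    n ^ 5 * m ^ (T * 4)
  ≡⟨ cong (λ z → n ^ 5 * m ^ z) (sym e) ⟩
    n ^ 5 * m ^ (m * (V * 5) + r)
  ≡⟨ cong (n ^ 5 *_) (trans (^-distribˡ-+-* m (m * (V * 5)) r) (cong (_* m ^ r) (sym (^-*-assoc m m (V * 5))))) ⟩
    n ^ 5 * ((m ^ m) ^ (V * 5) * m ^ r)
  ≤⟨ *-monoˡ-≤ _ (^-monoˡ-≤ 5 (<⇒≤ n<)) ⟩
    (2 ^ V) ^ 5 * ((m ^ m) ^ (V * 5) * m ^ r)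
  ≡⟨ cong (_* ((m ^ m) ^ (V * 5) * m ^ r)) (^-*-assoc 2 V 5) ⟩
    2 ^ (V * 5) * ((m ^ m) ^ (V * 5) * m ^ r)
  ≡⟨ sym (*-assoc (2 ^ (V * 5)) _ _) ⟩
    2 ^ (V * 5) * (m ^ m) ^ (V * 5) * m ^ r
  ≡⟨ cong (_* m ^ r) (sym (^-distribʳ-* 2 (m ^ m) (V * 5))) ⟩
    (2 * m ^ m) ^ (V * 5) * m ^ r
  ≤⟨ *-mono-≤ (^-monoˡ-≤ (V * 5) (bernoulli-2 m 1≤m)) (^-monoˡ-≤ r (m≤m+n m 1)) ⟩
    ((m + 1) ^ m) ^ (V * 5) * (m + 1) ^ r
  ≡⟨ cong (_* (m + 1) ^ r) (^-*-assoc (m + 1) m (V * 5)) ⟩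
    (m + 1) ^ (m * (V * 5)) * (m + 1) ^ r
  ≡⟨ sym (^-distribˡ-+-* (m + 1) (m * (V * 5)) r) ⟩
    (m + 1) ^ (m * (V * 5) + r)
  ≡⟨ cong ((m + 1) ^_) e ⟩
    (m + 1) ^ (T * 4) ∎
  where open ≤-Reasoning

cubic-bound : ∀ g h → 20 ≤ g → 19 ≤ h → 9 * (g + 1) * (suc h * suc h) + 8 * suc h ≤ 12 * g * (h * h)
cubic-bound g h 20≤g 19≤h =
  subst₂ Cubic (m∸n+n≡m 20≤g) (m∸n+n≡m 19≤h) (shifted (g ∸ 20) (h ∸ 19))
  where
  Cubic : ℕ → ℕ → Set
  Cubic g h = 9 * (g + 1) * (suc h * suc h) + 8 * suc h ≤ 12 * g * (h * h)
  difference : ℕ → ℕ → ℕ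
  difference g' h' = (3 * g' + 51) * h' * h' + (96 * g' + 1552) * h' + 732 * g' + 10880
  expand : ∀ g' h' → 9 * (g' + 20 + 1) * (suc (h' + 19) * suc (h' + 19)) + 8 * suc (h' + 19)
                       + ((3 * g' + 51) * h' * h' + (96 * g' + 1552) * h' + 732 * g' + 10880)
                     ≡ 12 * (g' + 20) * ((h' + 19) * (h' + 19))
  expand = solve-∀
  shifted : ∀ g' h' → Cubic (g' + 20) (h' + 19)
  shifted g' h' = ≤-trans (m≤m+n (9 * (g' + 20 + 1) * (suc (h' + 19) * suc (h' + 19)) + 8 * suc (h' + 19))
                                 (difference g' h'))
                          (≤-reflexive (expand g' h'))

-- The margin D = J - μ chosen from the degeneracy bound leaves room for the
-- E/h + 2 units spent in colour-ratio-bound plus 5(g+1)(h+1)/4 for tail-decay.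
degree-margin : ∀ g h μ a D → 20 ≤ g → 19 ≤ h → (g + 1) * (h * h) ≤ μ → h * a ≤ suc μ →
       suc μ ≤ (g + 1) * (suc h * suc h) → 9 * μ * g ≤ D * D →
       5 * (g + 1) * suc h + 4 * a + 8 ≤ 4 * D
degree-margin g h μ a D 20≤g 19≤h Vh2≤μ ha≤ μ≤ 9μg≤ = *-cancelˡ-≤ h {{hnz}} (square-reflects-≤ (h * Z) (h * (4 * D)) squares)
  where
  open ≤-Reasoning
  V = g + 1
  m = suc h
  Z = 5 * (g + 1) * suc h + 4 * a + 8
  linear≤cubic : h * Z ≤ 9 * V * (m * m) + 8 * m
  linear≤cubic = begin
      h * Z
    ≡⟨ e1 h g a ⟩
      5 * V * m * h + 4 * (h * a) + 8 * h
    ≤⟨ +-mono-≤ (+-mono-≤ (*-monoʳ-≤ (5 * V * m) (n≤1+n h)) (*-monoʳ-≤ 4 (≤-trans ha≤ μ≤))) (*-monoʳ-≤ 8 (n≤1+n h)) ⟩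
      5 * V * m * m + 4 * (V * (m * m)) + 8 * m
    ≡⟨ e2 V m ⟩
      9 * V * (m * m) + 8 * m ∎
    where e1 : ∀ x y z → x * (5 * (y + 1) * suc x + 4 * z + 8) ≡ 5 * (y + 1) * suc x * x + 4 * (x * z) + 8 * x
          e1 = solve-∀
          e2 : ∀ x y → 5 * x * y * y + 4 * (x * (y * y)) + 8 * y ≡ 9 * x * (y * y) + 8 * y
          e2 = solve-∀
  hnz : NonZero h
  hnz = >-nonZero (≤-trans (s≤s z≤n) 19≤h)
  cubic≤ : 9 * V * (m * m) + 8 * m ≤ 12 * g * (h * h)
  cubic≤ = cubic-bound g h 20≤g 19≤h
  squares : h * Z * (h * Z) ≤ h * (4 * D) * (h * (4 * D))
  squares = begin
      h * Z * (h * Z)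
    ≤⟨ *-mono-≤ (≤-trans linear≤cubic cubic≤) (≤-trans linear≤cubic cubic≤) ⟩
      12 * g * (h * h) * (12 * g * (h * h))
    ≡⟨ e3 g h ⟩
      144 * (h * h) * (h * h) * g * g
    ≤⟨ *-monoʳ-≤ (144 * (h * h) * (h * h) * g) (m≤m+n g 1) ⟩
      144 * (h * h) * (h * h) * g * V
    ≡⟨ e4 g h ⟩
      16 * (h * h) * (9 * g) * (V * (h * h)) * 1
    ≤⟨ *-monoˡ-≤ 1 (*-monoʳ-≤ (16 * (h * h) * (9 * g)) Vh2≤μ) ⟩
      16 * (h * h) * (9 * g) * μ * 1
    ≡⟨ e5 h g μ ⟩
      16 * (h * h) * (9 * μ * g)
    ≤⟨ *-monoʳ-≤ (16 * (h * h)) 9μg≤ ⟩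
      16 * (h * h) * (D * D)
    ≡⟨ e6 h D ⟩
      h * (4 * D) * (h * (4 * D)) ∎
    where e3 : ∀ x y → 12 * x * (y * y) * (12 * x * (y * y)) ≡ 144 * (y * y) * (y * y) * x * x
          e3 = solve-∀
          e4 : ∀ x y → 144 * (y * y) * (y * y) * x * (x + 1) ≡ 16 * (y * y) * (9 * x) * ((x + 1) * (y * y)) * 1
          e4 = solve-∀
          e5 : ∀ y x z → 16 * (y * y) * (9 * x) * z * 1 ≡ 16 * (y * y) * (9 * z * x)
          e5 = solve-∀
          e6 : ∀ y w → 16 * (y * y) * (w * w) ≡ y * (4 * w) * (y * (4 * w))
          e6 = solve-∀

-- n < 2^n, so that ⌊log n⌋ exists.
n<2^n : ∀ n → n < 2 ^ n
n<2^n zero = s≤s z≤n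
n<2^n (suc n) = ≤-trans (s≤s (n<2^n n)) (≤-trans (≤-reflexive (+-comm 1 (2 ^ n)))
   (≤-trans (+-monoʳ-≤ (2 ^ n) (m^n>0 2 n)) (≤-reflexive (cong (2 ^ n +_) (sym (+-identityʳ (2 ^ n)))))))

pow-succ-short : ∀ ℓ j → 1 ≤ ℓ → j ≤ ℓ → (ℓ + 1) ^ j ≤ 3 * ℓ ^ j
pow-succ-short ℓ@(suc _) j _ j≤ℓ = *-cancelʳ-≤ _ _ (ℓ * ℓ) (begin
    (ℓ + 1) ^ j * (ℓ * ℓ) ≤⟨ binomial-upper ℓ j j≤ℓ ⟩
    ℓ ^ j * (ℓ * ℓ + j * ℓ + j * j) ≤⟨ *-monoʳ-≤ (ℓ ^ j) (+-mono-≤ (+-monoʳ-≤ (ℓ * ℓ) (*-monoˡ-≤ ℓ j≤ℓ)) (*-mono-≤ j≤ℓ j≤ℓ)) ⟩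
    ℓ ^ j * (ℓ * ℓ + ℓ * ℓ + ℓ * ℓ) ≡⟨ lem (ℓ ^ j) ℓ ⟩
    3 * ℓ ^ j * (ℓ * ℓ) ∎)
  where open ≤-Reasoning
        lem : ∀ X ℓ → X * (ℓ * ℓ + ℓ * ℓ + ℓ * ℓ) ≡ 3 * X * (ℓ * ℓ)
        lem = solve-∀

pow-succ-long : ∀ ℓ n .{{_ : NonZero ℓ}} → (ℓ + 1) ^ n ≤ 3 ^ suc (n / ℓ) * ℓ ^ n
pow-succ-long ℓ n = begin
    (ℓ + 1) ^ n ≡⟨ cong ((ℓ + 1) ^_) eN ⟩
    (ℓ + 1) ^ (r + A * ℓ) ≡⟨ ^-distribˡ-+-* (ℓ + 1) r (A * ℓ) ⟩
    (ℓ + 1) ^ r * (ℓ + 1) ^ (A * ℓ) ≡⟨ cong ((ℓ + 1) ^ r *_) (trans (cong ((ℓ + 1) ^_) (*-comm A ℓ)) (sym (^-*-assoc (ℓ + 1) ℓ A))) ⟩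
    (ℓ + 1) ^ r * ((ℓ + 1) ^ ℓ) ^ A ≤⟨ *-mono-≤ (pow-succ-short ℓ r 1≤ℓ (<⇒≤ (m%n<n n ℓ))) (^-monoˡ-≤ A (pow-succ-short ℓ ℓ 1≤ℓ ≤-refl)) ⟩
    3 * ℓ ^ r * (3 * ℓ ^ ℓ) ^ A ≡⟨ cong (3 * ℓ ^ r *_) (trans (^-distribʳ-* 3 (ℓ ^ ℓ) A) (cong (3 ^ A *_) (^-*-assoc ℓ ℓ A))) ⟩
    3 * ℓ ^ r * (3 ^ A * ℓ ^ (ℓ * A)) ≡⟨ lem 3 (ℓ ^ r) (3 ^ A) (ℓ ^ (ℓ * A)) ⟩
    3 * 3 ^ A * (ℓ ^ r * ℓ ^ (ℓ * A)) ≡⟨ cong (3 * 3 ^ A *_) (trans (sym (^-distribˡ-+-* ℓ r (ℓ * A))) (cong (ℓ ^_) (trans (cong (r +_) (*-comm ℓ A)) (sym eN)))) ⟩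
    3 * 3 ^ A * ℓ ^ n ∎
  where open ≤-Reasoning
        A = n / ℓ
        r = n % ℓ
        eN : n ≡ r + A * ℓ
        eN = m≡m%n+[m/n]*n n ℓ
        1≤ℓ : 1 ≤ ℓ
        1≤ℓ = >-nonZero⁻¹ ℓ
        lem : ∀ a b c d → a * b * (c * d) ≡ a * c * (b * d)
        lem = solve-∀


-- Exponential-moment bound for the size of colour class i: weighting ψ by
-- 2^|ψ⁻¹(i)| gives  #{ψ : |ψ⁻¹(i)| ≥ M} · 2^M ≤ (ℓ + 1)^n.
class-size-tail : ∀ {n ℓ} (i : Fin ℓ) M →
  colSum {n} {ℓ} (λ ψ → ind ⌊ M ≤? count (colourClass ψ i) ⌋) * 2 ^ M ≤ (ℓ + 1) ^ n
class-size-tail {n} {ℓ} i M = begin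
    colSum {n} {ℓ} (λ ψ → ind (bad ψ)) * 2 ^ M
  ≡⟨ trans (*-comm _ (2 ^ M)) (sym (colSum-*ˡ {n} {ℓ} (λ ψ → ind (bad ψ)) (2 ^ M))) ⟩
    colSum {n} {ℓ} (λ ψ → 2 ^ M * ind (bad ψ))
  ≤⟨ colSum-mono {n} {ℓ} _ _ weight-dominates ⟩
    colSum {n} {ℓ} (λ ψ → prodFin (λ u → w (lookup ψ u)))
  ≡⟨ colSum-prod {n} {ℓ} (λ u → w) ⟩
    prodFin {n} (λ u → sumFin w)
  ≡⟨ trans (prodFin-cong {n} _ _ (λ u → trans (sumFin-bump i 1 1) (cong (_+ 1) (*-identityʳ ℓ)))) (prodFin-const n (ℓ + 1)) ⟩
    (ℓ + 1) ^ n ∎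
  where
  open ≤-Reasoning
  bad : Colouring n ℓ → Bool
  bad ψ = ⌊ M ≤? count (colourClass ψ i) ⌋
  w : Fin ℓ → ℕ
  w c = if ⌊ c Fin.≟ i ⌋ then 1 + 1 else 1
  weight-dominates : ∀ ψ → 2 ^ M * ind (bad ψ) ≤ prodFin (λ u → w (lookup ψ u))
  weight-dominates ψ = go (bad ψ) refl
    where
    go : ∀ b → bad ψ ≡ b → 2 ^ M * ind b ≤ prodFin (λ u → w (lookup ψ u))
    go false _ = ≤-trans (≤-reflexive (*-zeroʳ (2 ^ M))) z≤n
    go true e = begin
        2 ^ M * 1 ≡⟨ *-identityʳ _ ⟩
        2 ^ M ≤⟨ ^-monoʳ-≤ 2 (isYes-sound (M ≤? count (colourClass ψ i)) e) ⟩
        2 ^ count (colourClass ψ i) ≡⟨ sym (*-identityʳ _) ⟩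
        2 ^ count (colourClass ψ i) * 1 ≡⟨ cong (2 ^ count (colourClass ψ i) *_) (sym (^-zeroˡ (count (λ u → true ∧ not (colourClass ψ i u))))) ⟩
        2 ^ count (λ u → true ∧ colourClass ψ i u) * 1 ^ count (λ u → true ∧ not (colourClass ψ i u))
          ≡⟨ sym (prodFin-pow (λ _ → true) (colourClass ψ i) 2 1) ⟩
        prodFin (λ u → w (lookup ψ u)) ∎

-- For M = 2n/ℓ + 1 the bound above, multiplied by the ℓ classes, is below
-- ℓ^n · n^(-1/4) as soon as n/ℓ ≥ 5 log n + 12:  (ℓ c)^4 n ≤ (ℓ^n)^4.
class-size-bound : ∀ n ℓ g c .{{_ : NonZero ℓ}} → ℓ ≤ n → n < 2 ^ suc g → 5 * g + 12 ≤ n / ℓ →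
        c * 2 ^ suc (2 * n / ℓ) ≤ (ℓ + 1) ^ n → (ℓ * c) ^ 4 * n ≤ (ℓ ^ n) ^ 4
class-size-bound n ℓ g c ℓ≤n n< A-large tail = *-cancelʳ-≤ _ _ Z {{m^n≢0 (2 ^ M) 4 {{m^n≢0 2 M}}}} (begin
    (ℓ * c) ^ 4 * n * Z
  ≡⟨ e0 ℓ c n (2 ^ M) ⟩
    ℓ ^ 4 * n * (c * 2 ^ M) ^ 4
  ≤⟨ *-monoʳ-≤ (ℓ ^ 4 * n) (^-monoˡ-≤ 4 (≤-trans tail (pow-succ-long ℓ n))) ⟩
    ℓ ^ 4 * n * (3 ^ suc A * ℓ ^ n) ^ 4
  ≡⟨ e1 ℓ n (3 ^ suc A) (ℓ ^ n) ⟩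
    ℓ ^ 4 * n * (3 ^ suc A) ^ 4 * (ℓ ^ n) ^ 4
  ≤⟨ *-monoˡ-≤ ((ℓ ^ n) ^ 4) absorb-n ⟩
    Z * (ℓ ^ n) ^ 4 ≡⟨ *-comm Z _ ⟩
    (ℓ ^ n) ^ 4 * Z ∎)
  where
  open ≤-Reasoning
  A = n / ℓ
  M = suc (2 * n / ℓ)
  Z = (2 ^ M) ^ 4
  2A≤2n/ℓ : 2 * A ≤ 2 * n / ℓ
  2A≤2n/ℓ = ≤-/ (2 * A) (2 * n) ℓ (≤-trans (≤-reflexive (*-assoc 2 A ℓ)) (*-monoʳ-≤ 2 (m/n*n≤m n ℓ)))
  e0 : ∀ a b d x → (a * b) ^ 4 * d * x ^ 4 ≡ a ^ 4 * d * (b * x) ^ 4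
  e0 = solve 4 (λ a b d x → (a :* b) :^ 4 :* d :* x :^ 4 := a :^ 4 :* d :* (b :* x) :^ 4) refl
  e1 : ∀ a d p q → a ^ 4 * d * (p * q) ^ 4 ≡ a ^ 4 * d * p ^ 4 * q ^ 4
  e1 = solve 4 (λ a d p q → a :^ 4 :* d :* (p :* q) :^ 4 := a :^ 4 :* d :* p :^ 4 :* q :^ 4) refl
  P = 2 ^ (suc g * 5)
  Q = 81 ^ A
  ℓ⁴n≤P : ℓ ^ 4 * n ≤ P
  ℓ⁴n≤P = begin
      ℓ ^ 4 * n ≤⟨ *-monoˡ-≤ n (^-monoˡ-≤ 4 ℓ≤n) ⟩
      n ^ 4 * n ≡⟨ e2 n ⟩
      n ^ 5 ≤⟨ ^-monoˡ-≤ 5 (<⇒≤ n<) ⟩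
      (2 ^ suc g) ^ 5 ≡⟨ ^-*-assoc 2 (suc g) 5 ⟩
      P ∎
    where e2 : ∀ n → n ^ 4 * n ≡ n ^ 5
          e2 = solve 1 (λ n → n :^ 4 :* n := n :^ 5) refl
  e3 : (3 ^ suc A) ^ 4 ≡ 81 * Q
  e3 = trans (^-*-assoc 3 (suc A) 4) (trans (cong (3 ^_) (*-comm (suc A) 4))
         (trans (sym (^-*-assoc 3 4 (suc A))) refl))
  e4 : 2 ^ (suc (2 * A) * 4) ≡ 16 * 256 ^ A
  e4 = trans (cong (2 ^_) (ex A)) (trans (^-distribˡ-+-* 2 4 (8 * A)) (cong (16 *_) (sym (^-*-assoc 2 8 A))))
    where ex : ∀ A → suc (2 * A) * 4 ≡ 4 + 8 * A
          ex = solve-∀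
  e5 : 5 * g + 12 ≡ suc g * 5 + 7
  e5 = ex g
    where ex : ∀ g → 5 * g + 12 ≡ suc g * 5 + 7
          ex = solve-∀
  absorb-n : ℓ ^ 4 * n * (3 ^ suc A) ^ 4 ≤ Z
  absorb-n = begin
      ℓ ^ 4 * n * (3 ^ suc A) ^ 4 ≤⟨ *-monoˡ-≤ _ ℓ⁴n≤P ⟩
      P * (3 ^ suc A) ^ 4 ≡⟨ cong (P *_) e3 ⟩
      P * (81 * Q) ≡⟨ e6 P Q ⟩
      81 * (P * Q) ≤⟨ *-monoˡ-≤ (P * Q) (from-yes (81 ≤? 2048)) ⟩
      2048 * (P * Q) ≡⟨ e7 P Q ⟩
      16 * (Q * (P * 2 ^ 7)) ≡⟨ cong (λ z → 16 * (Q * z)) (sym (^-distribˡ-+-* 2 (suc g * 5) 7)) ⟩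
      16 * (Q * 2 ^ (suc g * 5 + 7)) ≡⟨ cong (λ z → 16 * (Q * 2 ^ z)) (sym e5) ⟩
      16 * (Q * 2 ^ (5 * g + 12)) ≤⟨ *-monoʳ-≤ 16 (*-monoʳ-≤ Q (^-monoʳ-≤ 2 A-large)) ⟩
      16 * (Q * 2 ^ A) ≡⟨ cong (16 *_) (sym (^-distribʳ-* 81 2 A)) ⟩
      16 * (162 ^ A) ≤⟨ *-monoʳ-≤ 16 (^-monoˡ-≤ A (from-yes (162 ≤? 256))) ⟩
      16 * 256 ^ A ≡⟨ sym e4 ⟩
      2 ^ (suc (2 * A) * 4) ≡⟨ sym (^-*-assoc 2 (suc (2 * A)) 4) ⟩
      (2 ^ suc (2 * A)) ^ 4 ≤⟨ ^-monoˡ-≤ 4 (^-monoʳ-≤ 2 (s≤s 2A≤2n/ℓ)) ⟩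
      Z ∎
    where e6 : ∀ P Q → P * (81 * Q) ≡ 81 * (P * Q)
          e6 = solve-∀
          e7 : ∀ P Q → 2048 * (P * Q) ≡ 16 * (Q * (P * 128))
          e7 = solve-∀


-- Combining the tail bound of SameColourTail with colour-ratio-bound and
-- tail-decay (for J = W + T, f ≤ K):  the number cnt of colourings with at
-- least J same-coloured forward neighbours satisfies cnt^4 n^5 ≤ L^4.
forward-tail-bound : ∀ cnt n ℓ m J f L K W T → 1 ≤ m → 1 ≤ ℓ → f ≤ K → J ≡ W + T →
   (m * ℓ + 1) ^ K * m ^ W ≤ (m * ℓ) ^ K * (m + 1) ^ W →
   n ^ 5 * m ^ (T * 4) ≤ (m + 1) ^ (T * 4) →
   cnt * ((m + 1) ^ J * m ^ f * ℓ ^ f) ≤ m ^ J * (L * (ℓ * m + 1) ^ f) →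
   cnt ^ 4 * n ^ 5 ≤ L ^ 4
forward-tail-bound cnt n ℓ m@(suc _) J f L K W T _ 1≤ℓ@(s≤s _) f≤K eJ comb tl tail =
  *-cancelʳ-≤ _ _ (R ^ 4) {{m^n≢0 R 4 {{Rnz}}}} (begin
    cnt ^ 4 * n ^ 5 * R ^ 4
  ≡⟨ E1 cnt (n ^ 5) R ⟩
    (cnt * R) ^ 4 * n ^ 5
  ≤⟨ *-monoˡ-≤ (n ^ 5) (^-monoˡ-≤ 4 cnt-bound) ⟩
    (m ^ J * L * α ^ f) ^ 4 * n ^ 5
  ≡⟨ E2 (m ^ J) L (α ^ f) (n ^ 5) ⟩
    L ^ 4 * ((α ^ f * m ^ J) ^ 4 * n ^ 5)
  ≤⟨ *-monoʳ-≤ (L ^ 4) ratio-and-decay ⟩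
    L ^ 4 * R ^ 4 ∎)
  where
  open ≤-Reasoning
  α = m * ℓ + 1
  β = m * ℓ
  R = (m + 1) ^ J * β ^ f
  βnz : NonZero β
  βnz = m*n≢0 m ℓ {{_}} {{>-nonZero 1≤ℓ}}
  Rnz : NonZero R
  Rnz = m*n≢0 ((m + 1) ^ J) (β ^ f) {{m^n≢0 (m + 1) J}} {{m^n≢0 β f {{βnz}}}}
  E1 : ∀ c d r → c ^ 4 * d * r ^ 4 ≡ (c * r) ^ 4 * d
  E1 = solve 3 (λ c d r → c :^ 4 :* d :* r :^ 4 := (c :* r) :^ 4 :* d) refl
  E2 : ∀ a b c d → (a * b * c) ^ 4 * d ≡ b ^ 4 * ((c * a) ^ 4 * d)
  E2 = solve 4 (λ a b c d → (a :* b :* c) :^ 4 :* d := b :^ 4 :* ((c :* a) :^ 4 :* d)) refl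
  cnt-bound : cnt * R ≤ m ^ J * L * α ^ f
  cnt-bound = begin
      cnt * R ≡⟨ cong (λ z → cnt * ((m + 1) ^ J * z)) (^-distribʳ-* m ℓ f) ⟩
      cnt * ((m + 1) ^ J * (m ^ f * ℓ ^ f)) ≡⟨ cong (cnt *_) (sym (*-assoc ((m + 1) ^ J) (m ^ f) (ℓ ^ f))) ⟩
      cnt * ((m + 1) ^ J * m ^ f * ℓ ^ f) ≤⟨ tail ⟩
      m ^ J * (L * (ℓ * m + 1) ^ f) ≡⟨ trans (sym (*-assoc (m ^ J) L _)) (cong (λ z → m ^ J * L * (z + 1) ^ f) (*-comm ℓ m)) ⟩
      m ^ J * L * α ^ f ∎
  f≤K-ratio : α ^ f * β ^ K ≤ α ^ K * β ^ f
  f≤K-ratio with m≤n⇒∃[o]m+o≡n f≤K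
  ... | e , refl = begin
      α ^ f * β ^ (f + e) ≡⟨ cong (α ^ f *_) (^-distribˡ-+-* β f e) ⟩
      α ^ f * (β ^ f * β ^ e) ≤⟨ *-monoʳ-≤ (α ^ f) (*-monoʳ-≤ (β ^ f) (^-monoˡ-≤ e (m≤m+n β 1))) ⟩
      α ^ f * (β ^ f * α ^ e) ≡⟨ E3 (α ^ f) (β ^ f) (α ^ e) ⟩
      α ^ f * α ^ e * β ^ f ≡⟨ cong (_* β ^ f) (sym (^-distribˡ-+-* α f e)) ⟩
      α ^ (f + e) * β ^ f ∎
    where E3 : ∀ a b c → a * (b * c) ≡ a * c * b
          E3 = solve-∀
  mJ : m ^ J ≡ m ^ W * m ^ T
  mJ = trans (cong (m ^_) eJ) (^-distribˡ-+-* m W T)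
  m1J : (m + 1) ^ J ≡ (m + 1) ^ W * (m + 1) ^ T
  m1J = trans (cong ((m + 1) ^_) eJ) (^-distribˡ-+-* (m + 1) W T)
  ratio-and-decay : (α ^ f * m ^ J) ^ 4 * n ^ 5 ≤ R ^ 4
  ratio-and-decay = *-cancelʳ-≤ _ _ ((β ^ K) ^ 4) {{m^n≢0 (β ^ K) 4 {{m^n≢0 β K {{βnz}}}}}} (begin
      (α ^ f * m ^ J) ^ 4 * n ^ 5 * (β ^ K) ^ 4
    ≡⟨ cong (λ z → (α ^ f * z) ^ 4 * n ^ 5 * (β ^ K) ^ 4) mJ ⟩
      (α ^ f * (m ^ W * m ^ T)) ^ 4 * n ^ 5 * (β ^ K) ^ 4
    ≡⟨ E4 (α ^ f) (m ^ W) (m ^ T) (n ^ 5) (β ^ K) ⟩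
      (α ^ f * β ^ K) ^ 4 * ((m ^ W) ^ 4 * ((m ^ T) ^ 4 * n ^ 5))
    ≤⟨ *-monoˡ-≤ _ (^-monoˡ-≤ 4 f≤K-ratio) ⟩
      (α ^ K * β ^ f) ^ 4 * ((m ^ W) ^ 4 * ((m ^ T) ^ 4 * n ^ 5))
    ≡⟨ E5 (α ^ K) (β ^ f) (m ^ W) ((m ^ T) ^ 4 * n ^ 5) ⟩
      (β ^ f) ^ 4 * ((α ^ K * m ^ W) ^ 4 * ((m ^ T) ^ 4 * n ^ 5))
    ≡⟨ cong (λ z → (β ^ f) ^ 4 * ((α ^ K * m ^ W) ^ 4 * z)) (trans (*-comm _ (n ^ 5)) (cong (n ^ 5 *_) (^-*-assoc m T 4))) ⟩
      (β ^ f) ^ 4 * ((α ^ K * m ^ W) ^ 4 * (n ^ 5 * m ^ (T * 4)))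
    ≤⟨ *-monoʳ-≤ ((β ^ f) ^ 4) (*-mono-≤ (^-monoˡ-≤ 4 comb) tl) ⟩
      (β ^ f) ^ 4 * ((β ^ K * (m + 1) ^ W) ^ 4 * (m + 1) ^ (T * 4))
    ≡⟨ cong (λ z → (β ^ f) ^ 4 * ((β ^ K * (m + 1) ^ W) ^ 4 * z)) (sym (^-*-assoc (m + 1) T 4)) ⟩
      (β ^ f) ^ 4 * ((β ^ K * (m + 1) ^ W) ^ 4 * ((m + 1) ^ T) ^ 4)
    ≡⟨ E6 (β ^ f) (β ^ K) ((m + 1) ^ W) ((m + 1) ^ T) ⟩
      ((m + 1) ^ W * (m + 1) ^ T * β ^ f) ^ 4 * (β ^ K) ^ 4
    ≡⟨ cong (λ z → (z * β ^ f) ^ 4 * (β ^ K) ^ 4) (sym m1J) ⟩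
      R ^ 4 * (β ^ K) ^ 4 ∎)
    where
    E4 : ∀ a w t d k → (a * (w * t)) ^ 4 * d * k ^ 4 ≡ (a * k) ^ 4 * (w ^ 4 * (t ^ 4 * d))
    E4 = solve 5 (λ a w t d k → (a :* (w :* t)) :^ 4 :* d :* k :^ 4 := (a :* k) :^ 4 :* (w :^ 4 :* (t :^ 4 :* d))) refl
    E5 : ∀ a b w z → (a * b) ^ 4 * (w ^ 4 * z) ≡ b ^ 4 * ((a * w) ^ 4 * z)
    E5 = solve 4 (λ a b w z → (a :* b) :^ 4 :* (w :^ 4 :* z) := b :^ 4 :* ((a :* w) :^ 4 :* z)) refl
    E6 : ∀ b k w t → b ^ 4 * ((k * w) ^ 4 * t ^ 4) ≡ (w * t * b) ^ 4 * k ^ 4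
    E6 = solve 4 (λ b k w t → b :^ 4 :* ((k :* w) :^ 4 :* t :^ 4) := (w :* t :* b) :^ 4 :* k :^ 4) refl


ceilDiv-upper : ∀ a s .{{_ : NonZero s}} → ceilDiv a s * s < a + s
ceilDiv-upper a s@(suc s') = begin-strict
    q * s      ≤⟨ m≤n+m (q * s) ((a + s') % s) ⟩
    (a + s') % s + q * s ≡⟨ sym (m≡m%n+[m/n]*n (a + s') s) ⟩
    a + s'     <⟨ +-monoʳ-< a (n<1+n s') ⟩
    a + s      ∎
  where open ≤-Reasoning
        q = (a + s') / s

ceilDiv-lower : ∀ a s .{{_ : NonZero s}} → a ≤ ceilDiv a s * s
ceilDiv-lower a s@(suc s') = +-cancelʳ-≤ s' a (q * s) (begin
    a + s'                ≡⟨ m≡m%n+[m/n]*n (a + s') s ⟩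
    (a + s') % s + q * s  ≤⟨ +-monoˡ-≤ (q * s) (≤-pred (m%n<n (a + s') s)) ⟩
    s' + q * s            ≡⟨ +-comm s' _ ⟩
    q * s + s'            ∎)
  where open ≤-Reasoning
        q = (a + s') / s

ceilDiv-upper-2 : ∀ a s ℓ → ℓ * s < a + s → 2 ≤ ℓ → ℓ * s < 2 * a
ceilDiv-upper-2 a s (suc ℓ') ℓs<a+s (s≤s 1≤ℓ') = begin-strict
    s + ℓ' * s   <⟨ ℓs<a+s ⟩
    a + s        <⟨ +-monoʳ-< a s<a ⟩
    a + a        ≡⟨ cong (a +_) (sym (+-identityʳ a)) ⟩
    2 * a        ∎
  where open ≤-Reasoning
        s<a : s < a
        s<a = ≤-trans (s≤s (m≤n*m s ℓ' {{>-nonZero 1≤ℓ'}}))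
                      (+-cancelˡ-< s (ℓ' * s) a (≤-trans ℓs<a+s (≤-reflexive (+-comm a s))))

log₂ : ∀ n → 1 ≤ n → ∃ λ g → 2 ^ g ≤ n × n < 2 ^ suc g
log₂ n 1≤n with least (λ g → n < 2 ^ suc g) (λ g → n <? 2 ^ suc g) n
                      (≤-trans (n<2^n n) (^-monoʳ-≤ 2 (n≤1+n n)))
... | zero  , n<2 , _     = zero , 1≤n , n<2
... | suc g , n<  , below = suc g , ≮⇒≥ (below g ≤-refl) , n<

-- The constant C of the theorem (kept abstract so that it is never unfolded).
abstract
  C : ℕ
  C = 2 ^ 21

  C≡2^21 : C ≡ 2 ^ 21
  C≡2^21 = refl

*C-large : ∀ g c → c ≤ 2 ^ 21 → g * c ≤ g * C
*C-large g c c≤ = *-monoʳ-≤ g (subst (c ≤_) (sym C≡2^21) c≤)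

C-pos : 0 < C
C-pos = subst (0 <_) (sym C≡2^21) (m^n>0 2 21)

sparsity : ∀ n g s → 2 ^ g ≤ n → n ^ (C * n) ≤ 2 ^ s → g * (C * n) ≤ s
sparsity n g s 2^g≤n H = 2^-reflects-≤ _ _ (begin
    2 ^ (g * (C * n))  ≡⟨ sym (^-*-assoc 2 g (C * n)) ⟩
    (2 ^ g) ^ (C * n)  ≤⟨ ^-monoˡ-≤ (C * n) 2^g≤n ⟩
    n ^ (C * n)        ≤⟨ H ⟩
    2 ^ s              ∎)
  where open ≤-Reasoning

log-large : ∀ n g → 1 ≤ g → g * C < 2 * n → n < 2 ^ suc g → 20 ≤ g
log-large n g 1≤g gC<2n n< with 20 ≤? g
... | yes p = p
... | no ¬p = ⊥-elim (<⇒≱ gC<C (≤-trans (≤-reflexive (sym (*-identityˡ C))) (*-monoˡ-≤ C 1≤g)))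
  where
  gC<C : g * C < C
  gC<C = begin-strict
      g * C            <⟨ gC<2n ⟩
      2 * n            <⟨ *-monoʳ-< 2 n< ⟩
      2 ^ suc (suc g)  ≤⟨ ^-monoʳ-≤ 2 (s≤s (s≤s (≤-pred (≰⇒> ¬p)))) ⟩
      2 ^ 21           ≡⟨ sym C≡2^21 ⟩
      C                ∎
    where open ≤-Reasoning

-- The nontrivial regime: n, ℓ ≥ 2, g = ⌊log n⌋ ≥ 1, s ≥ g C n, and
-- ℓ = ⌈2nk/s⌉ in the form 2nk ≤ ℓ s < 4nk.
record Regime (n k s ℓ : ℕ) : Set where
  field
    g       : ℕ
    2≤n     : 2 ≤ n
    2≤ℓ     : 2 ≤ ℓ
    k≤n     : k ≤ n
    1≤g     : 1 ≤ g
    2^g≤n   : 2 ^ g ≤ n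
    n<2^g+1 : n < 2 ^ suc g
    gCn≤s   : g * (C * n) ≤ s
    2nk≤ℓs  : 2 * n * k ≤ ℓ * s
    ℓs<4nk  : ℓ * s < 2 * (2 * n * k)

  instance
    ℓ-nonZero : NonZero ℓ
    ℓ-nonZero = >-nonZero (≤-trans (s≤s z≤n) 2≤ℓ)
    n-nonZero : NonZero n
    n-nonZero = >-nonZero (≤-trans (s≤s z≤n) 2≤n)

  1≤ℓ : 1 ≤ ℓ
  1≤ℓ = ≤-trans (s≤s z≤n) 2≤ℓ

module DegeneracyAndEdges {n k s ℓ : ℕ} (R : Regime n k s ℓ) (G : Graph n) (κ : ℕ)
  (r : Fin n → ℕ) (r-inj : ∀ u v → r u ≡ r v → u ≡ v) (r-fwd : ∀ v → count (Forward G r v) ≤ κ)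
  (k≤2κ : k ≤ 2 * κ) where

  open Regime R
  open Ranked G r r-inj

  -- n < 2^V
  V : ℕ
  V = g + 1

  ℓgC<8κ : ℓ * g * C < 8 * κ
  ℓgC<8κ = *-cancelˡ-< n _ _ (begin-strict
      n * (ℓ * g * C) ≡⟨ e1 n ℓ g C ⟩
      ℓ * (g * (C * n)) ≤⟨ *-monoʳ-≤ ℓ gCn≤s ⟩
      ℓ * s <⟨ ℓs<4nk ⟩
      2 * (2 * n * k) ≤⟨ *-monoʳ-≤ 2 (*-monoʳ-≤ (2 * n) k≤2κ) ⟩
      2 * (2 * n * (2 * κ)) ≡⟨ e2 n κ ⟩
      n * (8 * κ) ∎)
    where open ≤-Reasoning
          e1 : ∀ n ℓ g c → n * (ℓ * g * c) ≡ ℓ * (g * (c * n))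
          e1 = solve-∀
          e2 : ∀ n κ → 2 * (2 * n * (2 * κ)) ≡ n * (8 * κ)
          e2 = solve-∀

  gC<2n : g * C < 2 * n
  gC<2n = *-cancelˡ-< (2 * n) _ _ (begin-strict
      2 * n * (g * C) ≡⟨ e1 n g C ⟩
      2 * (g * (C * n)) ≤⟨ *-monoˡ-≤ (g * (C * n)) 2≤ℓ ⟩
      ℓ * (g * (C * n)) ≤⟨ *-monoʳ-≤ ℓ gCn≤s ⟩
      ℓ * s <⟨ ℓs<4nk ⟩
      2 * (2 * n * k) ≤⟨ *-monoʳ-≤ 2 (*-monoʳ-≤ (2 * n) k≤n) ⟩
      2 * (2 * n * n) ≡⟨ e2 n ⟩
      2 * n * (2 * n) ∎)
    where open ≤-Reasoning
          e1 : ∀ x y z → 2 * x * (y * z) ≡ 2 * (y * (z * x))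
          e1 = solve-∀
          e2 : ∀ x → 2 * (2 * x * x) ≡ 2 * x * (2 * x)
          e2 = solve-∀

  20≤g : 20 ≤ g
  20≤g = log-large n g 1≤g gC<2n n<2^g+1

  -- the expected forward degree inside a colour class is about μ
  μ : ℕ
  μ = κ / ℓ

  μℓ≤κ : μ * ℓ ≤ κ
  μℓ≤κ = m/n*n≤m κ ℓ

  κ<ℓsμ : κ < ℓ * suc μ
  κ<ℓsμ = begin-strict
      κ ≡⟨ m≡m%n+[m/n]*n κ ℓ ⟩
      κ % ℓ + μ * ℓ <⟨ +-monoˡ-< (μ * ℓ) (m%n<n κ ℓ) ⟩
      ℓ + μ * ℓ ≡⟨ cong (ℓ +_) (*-comm μ ℓ) ⟩
      ℓ + ℓ * μ ≡⟨ sym (*-suc ℓ μ) ⟩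
      ℓ * suc μ ∎
    where open ≤-Reasoning

  gC<8sμ : g * C < 8 * suc μ
  gC<8sμ = *-cancelˡ-< ℓ _ _ (begin-strict
      ℓ * (g * C) ≡⟨ sym (*-assoc ℓ g C) ⟩
      ℓ * g * C <⟨ ℓgC<8κ ⟩
      8 * κ <⟨ *-monoʳ-< 8 κ<ℓsμ ⟩
      8 * (ℓ * suc μ) ≡⟨ e ℓ (suc μ) ⟩
      ℓ * (8 * suc μ) ∎)
    where open ≤-Reasoning
          e : ∀ x y → 8 * (x * y) ≡ x * (8 * y)
          e = solve-∀

  9ℓg<κ : 9 * ℓ * g < κ
  9ℓg<κ = *-cancelˡ-< 8 _ _ (begin-strict
      8 * (9 * ℓ * g) ≡⟨ e ℓ g ⟩
      ℓ * g * 72 ≤⟨ *C-large (ℓ * g) 72 (from-yes (72 ≤? 2 ^ 21)) ⟩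
      ℓ * g * C <⟨ ℓgC<8κ ⟩
      8 * κ ∎)
    where open ≤-Reasoning
          e : ∀ x y → 8 * (9 * x * y) ≡ x * y * 72
          e = solve-∀

  ℓg≤κ : ℓ * g ≤ κ
  ℓg≤κ = ≤-trans (m≤n*m (ℓ * g) 9) (≤-trans (≤-reflexive (sym (*-assoc 9 ℓ g))) (<⇒≤ 9ℓg<κ))

  V-nonZero : NonZero V
  V-nonZero = >-nonZero (≤-trans (s≤s z≤n) (≤-reflexive (+-comm 1 g)))

  -- The weight parameter of the tail bound: m₀ = h + 1 is the least m with
  -- μ + 1 ≤ V m², so m₀ ≈ √(μ / log n); it is at least 20 as μ ≫ log n.
  Covers : ℕ → Set
  Covers m = suc μ ≤ V * (m * m)

  covers-μ+1 : Covers (suc μ)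
  covers-μ+1 = ≤-trans (m≤m*n (suc μ) (suc μ)) (m≤n*m (suc μ * suc μ) V {{V-nonZero}})

  m-choice : ∃ λ m → Covers m × (∀ j → j < m → ¬ Covers j)
  m-choice = least Covers (λ m → suc μ ≤? V * (m * m)) (suc μ) covers-μ+1

  m₀ : ℕ
  m₀ = proj₁ m-choice
  m₀-covers : Covers m₀
  m₀-covers = proj₁ (proj₂ m-choice)
  m₀-least : ∀ j → j < m₀ → ¬ Covers j
  m₀-least = proj₂ (proj₂ m-choice)

  m₀≤19⇒ : m₀ ≤ 19 → 8 * suc μ ≤ g * C
  m₀≤19⇒ m₀≤19 = begin
      8 * suc μ ≤⟨ *-monoʳ-≤ 8 (≤-trans m₀-covers (*-monoʳ-≤ V (*-mono-≤ m₀≤19 m₀≤19))) ⟩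
      8 * (V * (19 * 19)) ≡⟨ e g ⟩
      2888 * g + 2888 ≤⟨ +-monoʳ-≤ (2888 * g) (*-monoʳ-≤ 2888 1≤g) ⟩
      2888 * g + 2888 * g ≡⟨ e' g ⟩
      g * 5776 ≤⟨ *C-large g 5776 (from-yes (5776 ≤? 2 ^ 21)) ⟩
      g * C ∎
    where open ≤-Reasoning
          e : ∀ x → 8 * ((x + 1) * (19 * 19)) ≡ 2888 * x + 2888
          e = solve-∀
          e' : ∀ x → 2888 * x + 2888 * x ≡ x * 5776
          e' = solve-∀

  20≤m₀ : 20 ≤ m₀
  20≤m₀ = ≮⇒≥ (λ lt → <⇒≱ gC<8sμ (m₀≤19⇒ (≤-pred lt)))

  h : ℕ
  h = m₀ ∸ 1
  h+1≡m₀ : suc h ≡ m₀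
  h+1≡m₀ = trans (+-comm 1 h) (m∸n+n≡m (≤-trans (s≤s z≤n) 20≤m₀))

  19≤h : 19 ≤ h
  19≤h = ≤-pred (subst (20 ≤_) (sym h+1≡m₀) 20≤m₀)

  instance
    h-nonZero : NonZero h
    h-nonZero = >-nonZero (≤-trans (s≤s z≤n) 19≤h)

  μ+1≤V[h+1]² : suc μ ≤ V * (suc h * suc h)
  μ+1≤V[h+1]² = subst Covers (sym h+1≡m₀) m₀-covers

  Vh²≤μ : V * (h * h) ≤ μ
  Vh²≤μ = ≤-pred (≰⇒> (m₀-least h (subst (h <_) h+1≡m₀ ≤-refl)))

  a : ℕ
  a = suc μ / h

  ha≤μ+1 : h * a ≤ suc μ
  ha≤μ+1 = ≤-trans (≤-reflexive (*-comm h a)) (m/n*n≤m (suc μ) h)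

  -- The threshold: J₀ is the least J with 9κℓg ≤ (ℓJ - κ)², so every
  -- degeneracy d < J₀ satisfies the claimed bound (ℓd - κ)² < 9κℓ log n.
  Far : ℕ → Set
  Far J₀ = 9 * κ * ℓ * g ≤ (ℓ * J₀ ∸ κ) * (ℓ * J₀ ∸ κ)

  far-4κ : Far (4 * κ)
  far-4κ = begin
      9 * κ * ℓ * g ≡⟨ *-assoc (9 * κ) ℓ g ⟩
      9 * κ * (ℓ * g) ≤⟨ *-monoʳ-≤ (9 * κ) ℓg≤κ ⟩
      9 * κ * κ ≡⟨ e κ ⟩
      3 * κ * (3 * κ) ≤⟨ *-mono-≤ 3κ≤ 3κ≤ ⟩
      (ℓ * (4 * κ) ∸ κ) * (ℓ * (4 * κ) ∸ κ) ∎
    where open ≤-Reasoning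
          e : ∀ x → 9 * x * x ≡ 3 * x * (3 * x)
          e = solve-∀
          3κ≤ : 3 * κ ≤ ℓ * (4 * κ) ∸ κ
          3κ≤ = ≤-trans (≤-reflexive (sym (trans (cong (_∸ κ) (e2 κ)) (m+n∸n≡m (3 * κ) κ))))
                        (∸-monoˡ-≤ κ (m≤n*m (4 * κ) ℓ))
            where e2 : ∀ x → 4 * x ≡ 3 * x + x
                  e2 = solve-∀

  J-choice : ∃ λ J₀ → Far J₀ × (∀ j → j < J₀ → ¬ Far j)
  J-choice = least Far (λ J₀ → 9 * κ * ℓ * g ≤? (ℓ * J₀ ∸ κ) * (ℓ * J₀ ∸ κ)) (4 * κ) far-4κ

  J₀ : ℕ
  J₀ = proj₁ J-choice
  J-far : Far J₀
  J-far = proj₁ (proj₂ J-choice)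
  J-least : ∀ j → j < J₀ → ¬ Far j
  J-least = proj₂ (proj₂ J-choice)

  1≤κ : 1 ≤ κ
  1≤κ = ≤-trans (s≤s z≤n) 9ℓg<κ

  9κℓg-pos : 1 ≤ 9 * κ * ℓ * g
  9κℓg-pos = *-mono-≤ (*-mono-≤ (*-mono-≤ (s≤s {n = 8} z≤n) 1≤κ) 1≤ℓ) 1≤g

  κ<ℓJ : κ < ℓ * J₀
  κ<ℓJ = ≰⇒> (λ le → <⇒≱ 9κℓg-pos (≤-trans J-far (≤-reflexive
           (cong (λ z → z * z) (m≤n⇒m∸n≡0 le)))))

  μ<J₀ : μ < J₀
  μ<J₀ = *-cancelˡ-< ℓ μ J₀ (≤-trans (s≤s (≤-trans (≤-reflexive (*-comm ℓ μ)) μℓ≤κ)) κ<ℓJ)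

  D : ℕ
  D = J₀ ∸ μ
  μ+D≡J₀ : μ + D ≡ J₀
  μ+D≡J₀ = m+[n∸m]≡n (<⇒≤ μ<J₀)

  excess : ℕ
  excess = ℓ * J₀ ∸ κ

  excess≤ℓD : excess ≤ ℓ * D
  excess≤ℓD = ≤-trans (∸-monoʳ-≤ (ℓ * J₀) μℓ≤κ) (≤-reflexive (trans (cong (λ z → ℓ * z ∸ μ * ℓ) (sym μ+D≡J₀))
           (trans (cong (_∸ μ * ℓ) (e ℓ μ D)) (m+n∸m≡n (μ * ℓ) (ℓ * D)))))
    where e : ∀ x y z → x * (y + z) ≡ y * x + x * z
          e = solve-∀

  9μg≤DD : 9 * μ * g ≤ D * D
  9μg≤DD = *-cancelˡ-≤ (ℓ * ℓ) {{m*n≢0 ℓ ℓ}} (begin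
      ℓ * ℓ * (9 * μ * g) ≡⟨ e ℓ μ g ⟩
      9 * (μ * ℓ) * ℓ * g ≤⟨ *-monoˡ-≤ g (*-monoˡ-≤ ℓ (*-monoʳ-≤ 9 μℓ≤κ)) ⟩
      9 * κ * ℓ * g ≤⟨ J-far ⟩
      excess * excess ≤⟨ *-mono-≤ excess≤ℓD excess≤ℓD ⟩
      ℓ * D * (ℓ * D) ≡⟨ e' ℓ D ⟩
      ℓ * ℓ * (D * D) ∎)
    where open ≤-Reasoning
          e : ∀ x y z → x * x * (9 * y * z) ≡ 9 * (y * x) * x * z
          e = solve-∀
          e' : ∀ x y → x * y * (x * y) ≡ x * x * (y * y)
          e' = solve-∀

  -- The margin pays for both terms of the tail bound: J₀ = W + T below.
  margin : 5 * (g + 1) * suc h + 4 * a + 8 ≤ 4 * D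
  margin = degree-margin g h μ a D 20≤g 19≤h Vh²≤μ ha≤μ+1 μ+1≤V[h+1]² 9μg≤DD

  a+2≤D : a + 2 ≤ D
  a+2≤D = *-cancelˡ-≤ 4 (≤-trans (≤-reflexive (e a)) (≤-trans (m≤n+m (4 * a + 8) (5 * (g + 1) * suc h))
            (≤-trans (≤-reflexive (sym (+-assoc (5 * (g + 1) * suc h) (4 * a) 8))) margin)))
    where e : ∀ x → 4 * (x + 2) ≡ 4 * x + 8
          e = solve-∀

  T : ℕ
  T = D ∸ (a + 2)
  a+2+T≡D : a + 2 + T ≡ D
  a+2+T≡D = m+[n∸m]≡n a+2≤D

  W : ℕ
  W = suc μ + suc (suc μ / h)

  J₀≡W+T : J₀ ≡ W + T
  J₀≡W+T = trans (sym μ+D≡J₀) (trans (cong (μ +_) (sym a+2+T≡D)) (e μ a T))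
    where e : ∀ x y z → x + (y + 2 + z) ≡ suc x + suc y + z
          e = solve-∀

  tail-room : suc h * ((g + 1) * 5) ≤ T * 4
  tail-room = +-cancelʳ-≤ (4 * a + 8) _ _ (begin
      suc h * ((g + 1) * 5) + (4 * a + 8) ≡⟨ e h g a ⟩
      5 * (g + 1) * suc h + 4 * a + 8 ≤⟨ margin ⟩
      4 * D ≡⟨ cong (4 *_) (sym a+2+T≡D) ⟩
      4 * (a + 2 + T) ≡⟨ e' a T ⟩
      T * 4 + (4 * a + 8) ∎)
    where open ≤-Reasoning
          e : ∀ x y z → suc x * ((y + 1) * 5) + (4 * z + 8) ≡ 5 * (y + 1) * suc x + 4 * z + 8
          e = solve-∀
          e' : ∀ x y → 4 * (x + 2 + y) ≡ y * 4 + (4 * x + 8)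
          e' = solve-∀

  n<2^V : n < 2 ^ (g + 1)
  n<2^V = subst (λ z → n < 2 ^ z) (+-comm 1 g) n<2^g+1

  v∉forward : ∀ v → Forward G r v v ≡ false
  v∉forward v = cong (_∧ ⌊ r v <? r v ⌋) (irrefl G v)

  module AtVertex (v : Fin n) = SameColourTail {n} {ℓ} (Forward G r v) v (v∉forward v) (suc h) J₀

  tailCount : Fin n → ℕ
  tailCount v = colSum {n} {ℓ} (λ ψ → ind (AtVertex.Tail v ψ))

  tail-small : ∀ v → tailCount v ^ 4 * n ^ 5 ≤ (ℓ ^ n) ^ 4
  tail-small v = forward-tail-bound (tailCount v) n ℓ (suc h) J₀ (count (Forward G r v)) (ℓ ^ n) (ℓ * suc μ) W T (s≤s z≤n) 1≤ℓ
      (≤-trans (r-fwd v) (<⇒≤ κ<ℓsμ)) J₀≡W+T (colour-ratio-bound h ℓ μ 1≤ℓ)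
      (tail-decay (suc h) (g + 1) T n (s≤s z≤n) tail-room n<2^V) (AtVertex.tail-bound v)

  tail-small' : ∀ v → (n * tailCount v) ^ 4 * n ^ 1 ≤ (ℓ ^ n) ^ 4
  tail-small' v = ≤-trans (≤-reflexive (e n (tailCount v))) (tail-small v)
    where e : ∀ x y → (x * y) ^ 4 * x ^ 1 ≡ y ^ 4 * x ^ 5
          e = solve 2 (λ x y → (x :* y) :^ 4 :* x :^ 1 := y :^ 4 :* x :^ 5) refl

  few-same-coloured : WithProb≥1-n^-[ 1 / 4 ] n ℓ (λ ψ → ∀ v → AtVertex.Tail v ψ ≡ false)
  few-same-coloured = withProb-union {1} {3} (λ v ψ → AtVertex.Tail v ψ) tail-small'

  d₀ : ℕ
  d₀ = J₀ ∸ 1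
  d₀+1≡J₀ : suc d₀ ≡ J₀
  d₀+1≡J₀ = trans (+-comm 1 d₀) (m∸n+n≡m (≤-trans (s≤s z≤n) μ<J₀))

  forward≤d₀ : ∀ ψ → (∀ v → AtVertex.Tail v ψ ≡ false) → ∀ v → monoForward ψ v ≤ d₀
  forward≤d₀ ψ hψ v = ≤-pred (subst (monoForward ψ v <_) (sym d₀+1≡J₀)
                   (≰⇒> (isYes-no (J₀ ≤? monoForward ψ v) (hψ v))))

  below-J : ∀ d → d ≤ d₀ → (ℓ * d ∸ κ) * (ℓ * d ∸ κ) < 9 * κ * ℓ * g
  below-J d d≤ = ≰⇒> (J-least d (subst (d <_) d₀+1≡J₀ (s≤s d≤)))

  -- By minimality of J₀, ℓ(J₀ - 1) ≤ 2κ.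
  ℓJ'≤2κ : ℓ * d₀ ≤ 2 * κ
  ℓJ'≤2κ = begin
      ℓ * d₀ ≤⟨ m≤n+m∸n (ℓ * d₀) κ ⟩
      κ + (ℓ * d₀ ∸ κ) ≤⟨ +-monoʳ-≤ κ (<⇒≤ x<κ) ⟩
      κ + κ ≡⟨ cong (κ +_) (sym (+-identityʳ κ)) ⟩
      2 * κ ∎
    where
    open ≤-Reasoning
    x = ℓ * d₀ ∸ κ
    x<κ : x < κ
    x<κ = ≰⇒> (λ κ≤x → <⇒≱ (below-J d₀ ≤-refl) (≤-trans 9κℓg≤κκ (*-mono-≤ κ≤x κ≤x)))
      where 9κℓg≤κκ : 9 * κ * ℓ * g ≤ κ * κ
            9κℓg≤κκ = ≤-trans (≤-reflexive (e κ ℓ g)) (*-monoʳ-≤ κ (<⇒≤ 9ℓg<κ))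
              where e : ∀ x y z → 9 * x * y * z ≡ x * (9 * y * z)
                    e = solve-∀

  -- Claim (i): the colour classes are (J₀ - 1)-degenerate.
  degeneracy-claim : WithProb≥1-n^-[ 1 / 4 ] n ℓ (λ ψ → ∀ (i : Fin ℓ) (d : ℕ) → IsDegeneracyOn G (colourClass ψ i) d →
                    2 ^ ((ℓ * d ∸ κ) * (ℓ * d ∸ κ)) ≤ n ^ (9 * κ * ℓ))
  degeneracy-claim = withProb-map {1} {4} f few-same-coloured
    where
    f : ∀ ψ → (∀ v → AtVertex.Tail v ψ ≡ false) → ∀ (i : Fin ℓ) (d : ℕ) → IsDegeneracyOn G (colourClass ψ i) d →
          2 ^ ((ℓ * d ∸ κ) * (ℓ * d ∸ κ)) ≤ n ^ (9 * κ * ℓ)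
    f ψ hψ i d iso = begin
        2 ^ ((ℓ * d ∸ κ) * (ℓ * d ∸ κ)) ≤⟨ ^-monoʳ-≤ 2 (<⇒≤ (below-J d d≤d₀)) ⟩
        2 ^ (9 * κ * ℓ * g) ≡⟨ cong (2 ^_) (*-comm (9 * κ * ℓ) g) ⟩
        2 ^ (g * (9 * κ * ℓ)) ≡⟨ sym (^-*-assoc 2 g (9 * κ * ℓ)) ⟩
        (2 ^ g) ^ (9 * κ * ℓ) ≤⟨ ^-monoˡ-≤ (9 * κ * ℓ) 2^g≤n ⟩
        n ^ (9 * κ * ℓ) ∎
      where
      open ≤-Reasoning
      d≤d₀ : d ≤ d₀
      d≤d₀ = proj₂ iso d₀ (classes-degenerate ψ d₀ (forward≤d₀ ψ hψ) i)

  -- Claim (iii): at most n(J₀ - 1) ≤ 2nκ/ℓ ≤ s monochromatic edges.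
  edge-claim : κ ≤ k → WithProb≥1-n^-[ 1 / 4 ] n ℓ (λ ψ → monoEdges G ψ ≤ s)
  edge-claim κ≤k = withProb-map {1} {4} f few-same-coloured
    where
    nJ'≤s : n * d₀ ≤ s
    nJ'≤s = *-cancelˡ-≤ ℓ (begin
        ℓ * (n * d₀) ≡⟨ e ℓ n d₀ ⟩
        n * (ℓ * d₀) ≤⟨ *-monoʳ-≤ n ℓJ'≤2κ ⟩
        n * (2 * κ) ≤⟨ *-monoʳ-≤ n (*-monoʳ-≤ 2 κ≤k) ⟩
        n * (2 * k) ≡⟨ e' n k ⟩
        2 * n * k ≤⟨ 2nk≤ℓs ⟩
        ℓ * s ∎)
      where open ≤-Reasoning
            e : ∀ x y z → x * (y * z) ≡ y * (x * z)
            e = solve-∀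
            e' : ∀ x y → x * (2 * y) ≡ 2 * x * y
            e' = solve-∀
    f : ∀ ψ → (∀ v → AtVertex.Tail v ψ ≡ false) → monoEdges G ψ ≤ s
    f ψ hψ = ≤-trans (≤-reflexive (monoEdges≡sumForward ψ)) (≤-trans (sumFin-≤max (monoForward ψ) d₀ (forward≤d₀ ψ hψ)) nJ'≤s)


module ClassSizes {n k s ℓ : ℕ} (R : Regime n k s ℓ) where

  open Regime R

  A : ℕ
  A = n / ℓ

  n<[A+1]ℓ : n < suc A * ℓ
  n<[A+1]ℓ = begin-strict
      n ≡⟨ m≡m%n+[m/n]*n n ℓ ⟩
      n % ℓ + A * ℓ <⟨ +-monoˡ-< (A * ℓ) (m%n<n n ℓ) ⟩
      ℓ + A * ℓ ∎
    where open ≤-Reasoning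

  gC<4[A+1] : g * C < 4 * suc A
  gC<4[A+1] = *-cancelˡ-< n _ _ (*-cancelˡ-< ℓ _ _ (begin-strict
      ℓ * (n * (g * C)) ≡⟨ e1 ℓ n g C ⟩
      ℓ * (g * (C * n)) ≤⟨ *-monoʳ-≤ ℓ gCn≤s ⟩
      ℓ * s <⟨ ℓs<4nk ⟩
      2 * (2 * n * k) ≤⟨ *-monoʳ-≤ 2 (*-monoʳ-≤ (2 * n) k≤n) ⟩
      2 * (2 * n * n) ≤⟨ *-monoʳ-≤ 2 (*-monoʳ-≤ (2 * n) (<⇒≤ n<[A+1]ℓ)) ⟩
      2 * (2 * n * (suc A * ℓ)) ≡⟨ e2 n (suc A) ℓ ⟩
      ℓ * (n * (4 * suc A)) ∎))
    where open ≤-Reasoning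
          e1 : ∀ x y z w → x * (y * (z * w)) ≡ x * (z * (w * y))
          e1 = solve-∀
          e2 : ∀ x y z → 2 * (2 * x * (y * z)) ≡ z * (x * (4 * y))
          e2 = solve-∀

  A≥ : 5 * g + 12 ≤ A
  A≥ = ≮⇒≥ (λ lt → <⇒≱ gC<4[A+1] (begin
      4 * suc A ≤⟨ *-monoʳ-≤ 4 lt ⟩
      4 * (5 * g + 12) ≡⟨ e g ⟩
      20 * g + 48 ≤⟨ +-monoʳ-≤ (20 * g) (*-monoʳ-≤ 48 1≤g) ⟩
      20 * g + 48 * g ≡⟨ e' g ⟩
      g * 68 ≤⟨ *C-large g 68 (from-yes (68 ≤? 2 ^ 21)) ⟩
      g * C ∎))
    where open ≤-Reasoning
          e : ∀ x → 4 * (5 * x + 12) ≡ 20 * x + 48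
          e = solve-∀
          e' : ∀ x → 20 * x + 48 * x ≡ x * 68
          e' = solve-∀

  ℓ≤n : ℓ ≤ n
  ℓ≤n = ≤-trans (m≤n*m ℓ A {{>-nonZero (≤-trans (≤-trans (s≤s z≤n) (m≤n+m 12 (5 * g))) A≥)}}) (m/n*n≤m n ℓ)

  M : ℕ
  M = suc (2 * n / ℓ)

  bad : Fin ℓ → Colouring n ℓ → Bool
  bad i ψ = ⌊ M ≤? count (colourClass ψ i) ⌋

  class-rarely-large : ∀ i → (ℓ * colSum {n} {ℓ} (λ ψ → ind (bad i ψ))) ^ 4 * n ^ 1 ≤ (ℓ ^ n) ^ 4
  class-rarely-large i = ≤-trans (≤-reflexive (cong ((ℓ * size) ^ 4 *_) (*-identityʳ n)))
                 (class-size-bound n ℓ g size ℓ≤n n<2^g+1 A≥ (class-size-tail {n} {ℓ} i M))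
    where size = colSum {n} {ℓ} (λ ψ → ind (bad i ψ))

  size-claim : WithProb≥1-n^-[ 1 / 4 ] n ℓ (λ ψ → ∀ (i : Fin ℓ) → ℓ * count (colourClass ψ i) ≤ 2 * n)
  size-claim = withProb-map {1} {4} f (withProb-union {1} {3} bad class-rarely-large)
    where
    f : ∀ ψ → (∀ i → bad i ψ ≡ false) → ∀ i → ℓ * count (colourClass ψ i) ≤ 2 * n
    f ψ hψ i = ≤-trans (*-monoʳ-≤ ℓ (≤-pred (≰⇒> (isYes-no (M ≤? count (colourClass ψ i)) (hψ i)))))
                 (≤-trans (≤-reflexive (*-comm ℓ _)) (m/n*n≤m (2 * n) ℓ))


-- Reduction to the nontrivial regime.  For ℓ = ⌈2nk/s⌉ we have ℓ ≥ 1; if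
-- n ≤ 1 every event is likely, if ℓ = 1 a claim need only hold for every
-- colouring, and otherwise we are in the Regime.
by-regime : ∀ {n k s} → 1 ≤ k → k ≤ n → n ^ (C * n) ≤ 2 ^ s →
  (P : ∀ ℓ → Colouring n ℓ → Set) →
  (2 * n * k ≤ 1 * s → ∀ ψ → P 1 ψ) →
  (∀ {ℓ} → Regime n k s ℓ → WithProb≥1-n^-[ 1 / 4 ] n ℓ (P ℓ)) →
  ∀ ℓ → 2 * n * k ≤ ℓ * s → ℓ * s < 2 * n * k + s → WithProb≥1-n^-[ 1 / 4 ] n ℓ (P ℓ)
by-regime {n} {k} 1≤k k≤n H P single regime zero 2nk≤0 _ =
  ⊥-elim (<⇒≱ (*-mono-≤ (*-mono-≤ (s≤s {n = 1} z≤n) (≤-trans 1≤k k≤n)) 1≤k) 2nk≤0)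
by-regime {n} 1≤k k≤n H P single regime 1 2nk≤s _ = withProb-always {1} {3} n 1 (P 1) (single 2nk≤s)
by-regime {n} {k} {s} 1≤k k≤n H P single regime ℓ@(suc (suc _)) lower upper with n ≤? 1
... | yes n≤1 = withProb-small {1} {4} n ℓ (P ℓ) n≤1
... | no n≰1 with log₂ n (≤-trans 1≤k k≤n)
...   | zero  , _     , n<2 = ⊥-elim (<⇒≱ n<2 (≰⇒> n≰1))
...   | suc g , 2^g≤n , n<  = regime record
  { g = suc g ; 2≤n = ≰⇒> n≰1 ; 2≤ℓ = s≤s (s≤s z≤n) ; k≤n = k≤n ; 1≤g = s≤s z≤n
  ; 2^g≤n = 2^g≤n ; n<2^g+1 = n< ; gCn≤s = sparsity n (suc g) s 2^g≤n H
  ; 2nk≤ℓs = lower ; ℓs<4nk = ceilDiv-upper-2 (2 * n * k) s ℓ upper (s≤s (s≤s z≤n)) }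

single-colour-degeneracy : ∀ {n} (G : Graph n) κ → IsDegeneracy G κ → 1 ≤ n →
  ∀ (ψ : Colouring n 1) (i : Fin 1) d → IsDegeneracyOn G (colourClass ψ i) d →
  2 ^ ((1 * d ∸ κ) * (1 * d ∸ κ)) ≤ n ^ (9 * κ * 1)
single-colour-degeneracy {n} G κ isDeg 1≤n ψ i d isDeg-i =
  subst (λ x → 2 ^ (x * x) ≤ n ^ (9 * κ * 1)) (sym (m≤n⇒m∸n≡0 (≤-trans (≤-reflexive (*-identityˡ d)) d≤κ)))
        (m^n>0 n {{>-nonZero 1≤n}} (9 * κ * 1))
  where d≤κ : d ≤ κ
        d≤κ = proj₂ isDeg-i κ (λ S _ nonempty → proj₁ isDeg S (λ _ _ → refl) nonempty)

single-colour-size : ∀ {n} (ψ : Colouring n 1) (i : Fin 1) → 1 * count (colourClass ψ i) ≤ 2 * n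
single-colour-size {n} ψ i = ≤-trans (≤-reflexive (*-identityˡ _))
                               (≤-trans (count≤n (colourClass ψ i)) (m≤m+n n (n + 0)))

single-colour-edges : ∀ {n} (G : Graph n) (r : Fin n → ℕ) (r-inj : ∀ u v → r u ≡ r v → u ≡ v) κ →
  (∀ v → count (Forward G r v) ≤ κ) → ∀ k s → κ ≤ k → 2 * n * k ≤ 1 * s →
  ∀ (ψ : Colouring n 1) → monoEdges G ψ ≤ s
single-colour-edges {n} G r r-inj κ r-fwd k s κ≤k 2nk≤s ψ = begin
    monoEdges G ψ           ≡⟨ monoEdges≡sumForward ψ ⟩
    sumFin (monoForward ψ)  ≤⟨ sumFin-≤max (monoForward ψ) κ
                                 (λ v → ≤-trans (count-mono _ _ (λ u e → ∧-l {Forward G r v u} e)) (r-fwd v)) ⟩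
    n * κ                   ≤⟨ *-monoʳ-≤ n κ≤k ⟩
    n * k                   ≤⟨ m≤m+n (n * k) (n * k) ⟩
    n * k + n * k           ≡⟨ double n k ⟩
    2 * n * k               ≤⟨ 2nk≤s ⟩
    1 * s                   ≡⟨ *-identityˡ s ⟩
    s                       ∎
  where open ≤-Reasoning
        open Ranked G r r-inj
        double : ∀ x y → x * y + x * y ≡ 2 * x * y
        double = solve-∀

sparse-colouring :
  ∀ (n : ℕ) (G : Graph n) (κ : ℕ) → IsDegeneracy G κ →
  ∀ (k : ℕ) → 1 ≤ k → k ≤ n →
  ∀ (s : ℕ) → .{{_ : NonZero s}} → n ^ (C * n) ≤ 2 ^ s →
  let ℓ = ceilDiv (2 * n * k) s in
    (k ≤ 2 * κ → WithProb≥1-n^-[ 1 / 4 ] n ℓ (λ ψ →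
       ∀ (i : Fin ℓ) (d : ℕ) → IsDegeneracyOn G (colourClass ψ i) d →
         2 ^ ((ℓ * d ∸ κ) * (ℓ * d ∸ κ)) ≤ n ^ (9 * κ * ℓ)))
  × WithProb≥1-n^-[ 1 / 4 ] n ℓ (λ ψ →
       ∀ (i : Fin ℓ) → ℓ * count (colourClass ψ i) ≤ 2 * n)
  × (κ ≤ k → k ≤ 2 * κ → WithProb≥1-n^-[ 1 / 4 ] n ℓ (λ ψ →
       monoEdges G ψ ≤ s))
sparse-colouring n G κ isDeg k 1≤k k≤n s H =
    (λ k≤2κ → cases (λ ℓ ψ → ∀ i d → IsDegeneracyOn G (colourClass ψ i) d →
                               2 ^ ((ℓ * d ∸ κ) * (ℓ * d ∸ κ)) ≤ n ^ (9 * κ * ℓ))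
                    (λ _ → single-colour-degeneracy G κ isDeg (≤-trans 1≤k k≤n))
                    (λ R → DegeneracyAndEdges.degeneracy-claim R G κ r r-inj r-fwd k≤2κ))
  , cases (λ ℓ ψ → ∀ i → ℓ * count (colourClass ψ i) ≤ 2 * n)
          (λ _ → single-colour-size)
          (λ R → ClassSizes.size-claim R)
  , (λ κ≤k k≤2κ → cases (λ ℓ ψ → monoEdges G ψ ≤ s)
                        (single-colour-edges G r r-inj κ r-fwd k s κ≤k)
                        (λ R → DegeneracyAndEdges.edge-claim R G κ r r-inj r-fwd k≤2κ κ≤k))
  where
  ranking = degeneracy-ranking G κ (proj₁ isDeg)
  r = proj₁ ranking
  r-inj = proj₁ (proj₂ ranking)
  r-fwd = proj₂ (proj₂ ranking)
  ℓ = ceilDiv (2 * n * k) s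
  cases : (P : ∀ ℓ → Colouring n ℓ → Set) → (2 * n * k ≤ 1 * s → ∀ ψ → P 1 ψ) →
          (∀ {ℓ} → Regime n k s ℓ → WithProb≥1-n^-[ 1 / 4 ] n ℓ (P ℓ)) →
          WithProb≥1-n^-[ 1 / 4 ] n ℓ (P ℓ)
  cases P single regime = by-regime 1≤k k≤n H P single regime ℓ
                            (ceilDiv-lower (2 * n * k) s) (ceilDiv-upper (2 * n * k) s)

theorem3p1 :
    Σ ℕ λ C → Σ ℕ λ p → Σ ℕ λ q → 0 < C × 0 < p × 0 < q ×
      (∀ (n : ℕ) (G : Graph n) (κ : ℕ) → IsDegeneracy G κ →
       ∀ (k : ℕ) → 1 ≤ k → k ≤ n →
       ∀ (s : ℕ) → .{{_ : NonZero s}} → n ^ (C * n) ≤ 2 ^ s →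
       let ℓ = ceilDiv (2 * n * k) s in
         (k ≤ 2 * κ → WithProb≥1-n^-[ p / q ] n ℓ (λ ψ →
            ∀ (i : Fin ℓ) (d : ℕ) → IsDegeneracyOn G (colourClass ψ i) d →
              2 ^ ((ℓ * d ∸ κ) * (ℓ * d ∸ κ)) ≤ n ^ (9 * κ * ℓ)))
       × WithProb≥1-n^-[ p / q ] n ℓ (λ ψ →
            ∀ (i : Fin ℓ) → ℓ * count (colourClass ψ i) ≤ 2 * n)
       × (κ ≤ k → k ≤ 2 * κ → WithProb≥1-n^-[ p / q ] n ℓ (λ ψ →
            monoEdges G ψ ≤ s)))
theorem3p1 = C , 1 , 4 , C-pos , s≤s z≤n , s≤s z≤n , sparse-colouring
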